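{- Let $\mathbb{H}$ be a gehm with medial map $\mathbb{H}_m$ and medial weight system $\Omega_m(\mathbb{H})$. Then \[\Phi(\mathbb{H},\Omega_m(\mathbb{H}),v)=Z(\mathbb{H};u,v).\]
   Context: A gehm is a finite cubic graph whose edges are properly coloured with colours $b,g,r$, together with possibly some isolates ($g$-coloured edges meeting no vertex). Hyperedges are $b$--$r$-cycles, hyperfaces are $b$--$g$-cycles or isolates. $d(e)$ is half the number of gehm-edges in hyperedge $e$ (so the cycle $e$ has $2d(e)$ gehm-vertices); $d(A)=\sum_{e\in A}d(e)$. Suppressing a degree-two vertex: if its only edge is a loop, replace it and the loop by an isolate; otherwise contract one incident edge. Deleting a hyperedge $e$: delete its $b$-edges, contract its $r$-edges, suppress degree-two vertices. For $A\subseteq E(\mathbb{H})$, $\mathbb{H}_{|A}$ is obtained by deleting all hyperedges not in $A$, and $f(A)$ is its number of hyperfaces. $Z(\mathbb{H};u,v)=\sum_{A\subseteq E(\mathbb{H})}u^{d(A)-|A|}v^{f(A)}$. Medial map $\mathbb{H}_m$: it has one vertex $w_e$ for each hyperedge $e$, whose half-edges correspond to the $2d(e)$ gehm-vertices of the cycle $e$; each non-isolate $g$-edge $xy$ of $\mathbb{H}$ gives an edge of $\mathbb{H}_m$ joining the half-edge at $x$ (at $w_e$, $x\in e$) to the half-edge at $y$ (at $w_{e'}$, $y\in e'$); each isolate of $\mathbb{H}$ is retained as a free loop (an edge meeting no vertex). At $w_e$, list the half-edges $h_0,h_1,\dots,h_{2d-1}$ ($d=d(e)$) in the cyclic order of the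 corresponding gehm-vertices along the cycle $e$, chosen so that consecutive vertices $h_{2i},h_{2i+1}$ are joined by an $r$-edge of $e$ and $h_{2i+1},h_{2i+2}$ (indices mod $2d$) by a $b$-edge of $e$. (In the natural embedding, the $r$-edges border hypervertex faces, coloured grey, and the $b$-edges border hyperface faces, coloured white.) The $c$-state at $w_e$ pairs $\{h_1,h_2\},\{h_3,h_4\},\dots,\{h_{2d-1},h_0\}$; the $d$-state pairs $\{h_0,h_1\},\{h_2,h_3\},\dots,\{h_{2d-2},h_{2d-1}\}$. Weight system $\Omega_m(\mathbb{H})$: for vertices of degree $2d\ge 4$, pair weight $p(h_1,h_2)=p(h_3,h_4)=\dots=p(h_{2d-1},h_0)=u^{1-1/d}$, $p(h_0,h_1)=p(h_2,h_3)=\dots=p(h_{2d-2},h_{2d-1})=1$, and all other pairs weight $0$; for vertices of degree two, $p(h_0,h_1)=2$. A vertex state at a vertex is a partition of its incident half-edges into pairs; a graph state $s$ is a choice of vertex state at every vertex; its weight $\omega(s)$ is the product over all vertices of the products of the pair weights of the pairs in the chosen vertex states. Smoothing: at each vertex, for each pair replace the two paired half-edges by a single connection (so the result is a disjoint union of closed curves/free loops); $k(s)$ is the number of free loops resulting from smoothing all vertices according to $s$ (including the original free loops). The hypermap transition polynomial is $\Phi(\mathbb{H},\Omega,t)=\sum_{s}\omega(s)\,t^{k(s)}$, summing over all graph states of $\mathbb{H}_m$. -}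

module Defs where

open import Level using (Level)
open import Data.Nat.Base using (ℕ; zero; suc; _∸_; _≤ᵇ_; _<ᵇ_; _≡ᵇ_; ⌊_/2⌋)
  renaming (_+_ to _+ℕ_)
open import Data.Bool.Base using (Bool; true; false; if_then_else_; _∧_; not)
open import Data.Fin.Base using (Fin; toℕ)
open import Data.Fin.Properties using (_≟_)
open import Data.List.Base using (List; []; _∷_; map; length; foldr; allFin; concatMap; upTo)
open import Data.Bool.ListAction using (all; any)
open import Data.Vec.Base using (Vec; lookup) renaming ([] to []ᵥ; _∷_ to _∷ᵥ_)
open import Relation.Nullary.Decidable using (⌊_⌋)
open import Relation.Binary.PropositionalEquality using (_≡_; _≢_)
open import Algebra.Bundles using (CommutativeRing)

eqᵇ : ∀ {n} → Fin n → Fin n → Bool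
eqᵇ x y = ⌊ x ≟ y ⌋

count : ∀ {A : Set} → (A → Bool) → List A → ℕ
count p [] = 0
count p (x ∷ xs) = if p x then suc (count p xs) else count p xs

keep : ∀ {A : Set} → (A → Bool) → List A → List A
keep p [] = []
keep p (x ∷ xs) = if p x then x ∷ keep p xs else keep p xs

iter : ∀ {A : Set} → ℕ → (A → A) → A → A
iter zero f a = a
iter (suc k) f a = f (iter k f a)

-- all sublists (= subsets, for a duplicate-free list)
sublists : ∀ {A : Set} → List A → List (List A)
sublists [] = [] ∷ []
sublists (x ∷ xs) = let s = sublists xs in s Data.List.Base.++ map (x ∷_) s

allVecs : ∀ {n} (m : ℕ) → List (Vec (Fin n) m)
allVecs zero = []ᵥ ∷ []
allVecs {n} (suc m) = concatMap (λ x → map (x ∷ᵥ_) (allVecs m)) (allFin n)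

allFuns : ∀ n → List (Fin n → Fin n)
allFuns n = map lookup (allVecs n)

-- The orbit of x under the group generated by two involutions α, β of
-- Fin n (a dihedral group): the elements (αβ)^k x and β (αβ)^k x, k ≤ n.
orbit : ∀ {n} (α β : Fin n → Fin n) → Fin n → List (Fin n)
orbit {n} α β x =
  concatMap (λ k → let y = iter k (λ z → α (β z)) x in y ∷ β y ∷ []) (upTo (suc n))

sameOrbit : ∀ {n} (α β : Fin n → Fin n) → Fin n → Fin n → Bool
sameOrbit α β x y = any (eqᵇ y) (orbit α β x)

isRep : ∀ {n} (α β : Fin n → Fin n) → Fin n → Bool
isRep α β x = all (λ y → toℕ x ≤ᵇ toℕ y) (orbit α β x)

countOrbits : ∀ {n} (α β : Fin n → Fin n) → (Fin n → Bool) → ℕ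
countOrbits {n} α β alive = count (λ x → alive x ∧ isRep α β x) (allFin n)

-- Gehms: vertices Fin n; each vertex meets exactly one b-, g- and r-edge,
-- encoded by fixed-point-free involutions b, g, r (x's c-edge joins x and c x);
-- plus a number of isolates.

record Gehm : Set where
  field
    n        : ℕ
    b g r    : Fin n → Fin n
    b-invol  : ∀ x → b (b x) ≡ x
    g-invol  : ∀ x → g (g x) ≡ x
    r-invol  : ∀ x → r (r x) ≡ x
    b-fpf    : ∀ x → b x ≢ x
    g-fpf    : ∀ x → g x ≢ x
    r-fpf    : ∀ x → r x ≢ x
    isolates : ℕ

module _ (H : Gehm) where
  open Gehm H

  -- hyperedges (b–r-cycles), each represented by its least vertex
  hyperedges : List (Fin n)
  hyperedges = keep (isRep b r) (allFin n)

  inHyperedge : Fin n → Fin n → Bool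
  inHyperedge e y = sameOrbit b r e y

  deg : Fin n → ℕ
  deg e = ⌊ count (inHyperedge e) (allFin n) /2⌋

  dSum : List (Fin n) → ℕ
  dSum A = foldr (λ e s → deg e +ℕ s) 0 A

-- Intermediate gehms arising by deleting hyperedges: the surviving
-- vertices are those with alive = true, b g r are the current colourings
-- (meaningful on alive vertices), iso the current number of isolates.

record PGehm (n : ℕ) : Set where
  field
    alive : Fin n → Bool
    b g r : Fin n → Fin n
    iso   : ℕ

chase : ∀ {n} → (Fin n → Bool) → (Fin n → Fin n) → (Fin n → Fin n) →
        ℕ → Fin n → Fin n
chase alive g r zero y = y
chase alive g r (suc k) y = if alive y then y else chase alive g r k (g (r y))

-- Deleting the hyperedge e (the b–r-cycle through e): delete its b-edges,
-- contract its r-edges and suppress the resulting degree-two vertices.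
-- Every surviving vertex z whose g-edge enters e gets as new g-neighbour the
-- end of the g/r-alternating walk through e; every g/r-alternating cycle
-- lying inside e becomes a single vertex with a g-loop and hence an isolate.
deleteHE : ∀ {n} → PGehm n → Fin n → PGehm n
deleteHE {n} P e = record
  { alive = alive'
  ; b = b
  ; g = λ z → chase alive' g r n (g z)
  ; r = r
  ; iso = iso +ℕ newIso }
  where
    open PGehm P
    inE : Fin n → Bool
    inE y = sameOrbit b r e y
    alive' : Fin n → Bool
    alive' y = alive y ∧ not (inE y)
    newIso : ℕ
    newIso = count (λ y → alive y ∧ inE y ∧ isRep g r y ∧ all inE (orbit g r y))
                   (allFin n)

toP : (H : Gehm) → PGehm (Gehm.n H)
toP H = record { alive = λ _ → true ; b = b ; g = g ; r = r ; iso = isolates }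
  where open Gehm H

-- number of hyperfaces (b–g-cycles and isolates)
hyperfaces : ∀ {n} → PGehm n → ℕ
hyperfaces P = countOrbits b g alive +ℕ iso
  where open PGehm P

module _ (H : Gehm) where
  open Gehm H

  restrict : List (Fin n) → PGehm n
  restrict A = foldr (λ e P → deleteHE P e) (toP H)
                     (keep (λ e → not (any (eqᵇ e) A)) (hyperedges H))

  f : List (Fin n) → ℕ
  f A = hyperfaces (restrict A)

-- Medial map: half-edges are Fin n; two half-edges are at the same vertex
-- iff sameVertex; edge pairs the two half-edges of an edge; plus free loops.

record MedialMap : Set where
  field
    n          : ℕ
    sameVertex : Fin n → Fin n → Bool
    edge       : Fin n → Fin n
    freeLoops  : ℕ

-- H_m: vertex w_e per hyperedge e with half-edges the gehm-vertices of e,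
-- an edge per g-edge, a free loop per isolate.
medial : Gehm → MedialMap
medial H = record
  { n = n ; sameVertex = sameOrbit b r ; edge = g ; freeLoops = isolates }
  where open Gehm H

module _ {c ℓ : Level} (R : CommutativeRing c ℓ) where
  open CommutativeRing R renaming (Carrier to K)

  pow : K → ℕ → K
  pow x zero = 1#
  pow x (suc k) = x * pow x k

  sumK : List K → K
  sumK = foldr _+_ 0#

  prodK : List K → K
  prodK = foldr _*_ 1#

  module _ (M : MedialMap) where
    open MedialMap M

    WeightSystem : Set c
    WeightSystem = Fin n → Fin n → K

    -- graph states: at every vertex a partition of its half-edges into
    -- pairs; i.e. a fixed-point-free involution σ of the half-edges with
    -- σ x at the same vertex as x
    isGraphState : (Fin n → Fin n) → Bool
    isGraphState σ = all (λ x → not (eqᵇ (σ x) x) ∧ eqᵇ (σ (σ x)) x ∧ sameVertex x (σ x))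
                         (allFin n)

    graphStates : List (Fin n → Fin n)
    graphStates = keep isGraphState (allFuns n)

    -- ω(s): product of the weights of all pairs (each pair {x, σ x} once)
    ω : WeightSystem → (Fin n → Fin n) → K
    ω p σ = prodK (map (λ x → p x (σ x)) (keep (λ x → toℕ x <ᵇ toℕ (σ x)) (allFin n)))

    -- k(s): closed curves after smoothing (alternating edges and pairs)
    -- plus the original free loops
    kState : (Fin n → Fin n) → ℕ
    kState σ = countOrbits edge σ (λ _ → true) +ℕ freeLoops

    Φ : WeightSystem → K → K
    Φ p t = sumK (map (λ σ → ω p σ * pow t (kState σ)) graphStates)

  -- Ω_m(H); ρ d plays the role of u^{1-1/d}.  At w_e the pair
  -- {h_{2i+1},h_{2i+2}} consists of the ends of a b-edge of e, the pair
  -- {h_{2i},h_{2i+1}} the ends of an r-edge of e.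
  Ωm : (H : Gehm) → (ρ : ℕ → K) → WeightSystem (medial H)
  Ωm H ρ x y =
    if deg H x ≡ᵇ 1 then 1# + 1#
    else (if eqᵇ y (Gehm.b H x) then ρ (deg H x)
          else (if eqᵇ y (Gehm.r H x) then 1# else 0#))

  Z : Gehm → K → K → K
  Z H u v = sumK (map (λ A → pow u (dSum H A ∸ length A) * pow v (f H A))
                      (sublists (hyperedges H)))

-- All pairs at w_e other than the two ends of a b- or r-edge of the cycle e have weight 0, and a perfect
-- matching of a cycle by its own edges uses either all its b-edges (the c-state) or all its r-edges (the
-- d-state). So the graph states of nonzero weight are the states τ_A taking the c-state exactly at the
-- hyperedges in A, with weight ∏_{e ∈ A} (u^{1-1/d(e)})^{d(e)} = u^{d(A)-|A|} (when d(e) = 1 the two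
-- states coincide and carry 2 = 1 + u^0). Smoothing by τ_A leaves the orbits of ⟨g, τ_A⟩. Deleting a
-- hyperedge outside A, where τ_A = r, reroutes the g-edges through it without changing these orbits,
-- except that the g–r cycles inside it become isolates; once all are deleted, τ_A = b on what remains and
-- the orbits are the hyperfaces of H_{|A}, so k(τ_A) = f(A).
module Submission where

open import Defs
open import Level using (Level)
open import Data.Nat.Base using (ℕ; _≤_; _∸_)
open import Data.Bool.Base using (Bool; true)
open import Data.Fin.Base using (Fin)
open import Data.List.Base using (List)
open import Data.List.Membership.Propositional using (_∈_)
open import Relation.Binary.PropositionalEquality using (_≡_)
open import Algebra.Bundles using (CommutativeRing)

module Counting where

  open import Data.Nat.Base using (zero; suc; _+_; _<_; z≤n; s≤s; s≤s⁻¹; _≤ᵇ_; _<ᵇ_; ⌊_/2⌋)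
  open import Data.Nat.Properties
    using (≤-refl; ≤-trans; n≤1+n; +-suc; ≤-antisym; ≮⇒≥; <-≤-trans; <-cmp; <-irrefl; m≤n⇒m≤1+n; m≤n⇒m<n∨m≡n;
           +-0-commutativeMonoid; ≤ᵇ⇒≤; ≤⇒≤ᵇ; <ᵇ⇒<; <⇒<ᵇ)
  open import Data.Bool.Base using (false; if_then_else_; _∧_; _∨_; not)
  open import Data.Bool.Properties
    using (¬-not; not-¬; not-injective; ∧-zeroʳ; ∧-identityʳ; ∨-zeroʳ; T-≡) renaming (_≟_ to _≟ᵇ_)
  open import Data.Fin.Base using (zero; suc; toℕ)
  open import Data.Fin.Properties using (_≟_; toℕ-injective; suc-injective; any?)
  open import Data.Fin.Permutation using (permutation)
  open import Data.List.Base using ([]; _∷_; tabulate; allFin)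
  open import Data.Bool.ListAction using (all; any)
  open import Data.List.Relation.Unary.Any using (here; there)
  open import Data.List.Membership.Propositional.Properties using (∈-++⁻; ∈-map⁻)
  import Data.List.Relation.Unary.All as All
  open import Data.List.Relation.Unary.AllPairs using ([]; _∷_)
  open import Data.List.Relation.Unary.Unique.Propositional using (Unique)
  open import Data.Product using (∃; _×_; _,_; proj₂)
  open import Data.Sum using (_⊎_; inj₁; inj₂)
  open import Data.Empty using (⊥-elim)
  open import Function.Base using (_∘_; id)
  open import Function.Bundles using (module Equivalence)
  open import Relation.Nullary using (yes; no)
  open import Relation.Binary.PropositionalEquality
  open import Relation.Binary.Definitions using (tri<; tri≈; tri>)
  open import Algebra.Properties.CommutativeMonoid.Sum +-0-commutativeMonoid using (sum; sum-permute)

  ∧-intro : ∀ {a b} → a ≡ true → b ≡ true → a ∧ b ≡ true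
  ∧-intro = cong₂ _∧_

  ∧-elimˡ : ∀ {a b} → a ∧ b ≡ true → a ≡ true
  ∧-elimˡ {true} _ = refl

  ∧-elimʳ : ∀ {a b} → a ∧ b ≡ true → b ≡ true
  ∧-elimʳ {true} p = p

  ∧-falseʳ : ∀ {a b} → b ≡ false → a ∧ b ≡ false
  ∧-falseʳ {a} p = trans (cong (a ∧_) p) (∧-zeroʳ a)

  ∨-introˡ : ∀ {a b} → a ≡ true → a ∨ b ≡ true
  ∨-introˡ {b = b} p = cong (_∨ b) p

  ∨-introʳ : ∀ {a b} → b ≡ true → a ∨ b ≡ true
  ∨-introʳ {a} p = trans (cong (a ∨_) p) (∨-zeroʳ a)

  ∨-elim : ∀ {a b} → a ∨ b ≡ true → a ≡ true ⊎ b ≡ true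
  ∨-elim {true} _ = inj₁ refl
  ∨-elim {false} p = inj₂ p

  true≢false : ∀ {a} → a ≡ true → a ≢ false
  true≢false p = not-¬ p

  ⇔⇒≡ : ∀ {a b} → (a ≡ true → b ≡ true) → (b ≡ true → a ≡ true) → a ≡ b
  ⇔⇒≡ {true} to _ = sym (to refl)
  ⇔⇒≡ {false} {true} _ from = from refl
  ⇔⇒≡ {false} {false} _ _ = refl

  ≤ᵇ≡true⇒≤ : ∀ {m n} → (m ≤ᵇ n) ≡ true → m ≤ n
  ≤ᵇ≡true⇒≤ {m} {n} p = ≤ᵇ⇒≤ m n (Equivalence.from T-≡ p)

  ≤⇒≤ᵇ≡true : ∀ {m n} → m ≤ n → (m ≤ᵇ n) ≡ true
  ≤⇒≤ᵇ≡true p = Equivalence.to T-≡ (≤⇒≤ᵇ p)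

  <ᵇ≡true⇒< : ∀ {m n} → (m <ᵇ n) ≡ true → m < n
  <ᵇ≡true⇒< {m} {n} p = <ᵇ⇒< m n (Equivalence.from T-≡ p)

  <⇒<ᵇ≡true : ∀ {m n} → m < n → (m <ᵇ n) ≡ true
  <⇒<ᵇ≡true p = Equivalence.to T-≡ (<⇒<ᵇ p)

  eqᵇ-refl : ∀ {n} (x : Fin n) → eqᵇ x x ≡ true
  eqᵇ-refl x with x ≟ x
  ... | yes _ = refl
  ... | no x≢x = ⊥-elim (x≢x refl)

  eqᵇ⇒≡ : ∀ {n} {x y : Fin n} → eqᵇ x y ≡ true → x ≡ y
  eqᵇ⇒≡ {x = x} {y} p with x ≟ y
  ... | yes x≡y = x≡y

  ≢⇒eqᵇ≡false : ∀ {n} {x y : Fin n} → x ≢ y → eqᵇ x y ≡ false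
  ≢⇒eqᵇ≡false {x = x} {y} x≢y with x ≟ y
  ... | yes x≡y = ⊥-elim (x≢y x≡y)
  ... | no _ = refl

  eqᵇ≡false⇒≢ : ∀ {n} {x y : Fin n} → eqᵇ x y ≡ false → x ≢ y
  eqᵇ≡false⇒≢ {x = x} h refl = true≢false (eqᵇ-refl x) h

  any-∈⁺ : ∀ {A : Set} (p : A → Bool) {x} {xs : List A} → x ∈ xs → p x ≡ true → any p xs ≡ true
  any-∈⁺ p (here refl) px rewrite px = refl
  any-∈⁺ p {xs = y ∷ _} (there x∈xs) px with p y
  ... | true = refl
  ... | false = any-∈⁺ p x∈xs px

  any-∈⁻ : ∀ {A : Set} (p : A → Bool) (xs : List A) → any p xs ≡ true → ∃ λ x → x ∈ xs × p x ≡ true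
  any-∈⁻ p (y ∷ ys) h with p y in py
  ... | true = y , here refl , py
  ... | false with any-∈⁻ p ys h
  ... | x , x∈ys , px = x , there x∈ys , px

  all-∈⁺ : ∀ {A : Set} (p : A → Bool) (xs : List A) → (∀ x → x ∈ xs → p x ≡ true) → all p xs ≡ true
  all-∈⁺ p [] h = refl
  all-∈⁺ p (y ∷ ys) h rewrite h y (here refl) = all-∈⁺ p ys (λ x → h x ∘ there)

  all-∈⁻ : ∀ {A : Set} (p : A → Bool) {x} {xs : List A} → all p xs ≡ true → x ∈ xs → p x ≡ true
  all-∈⁻ p h (here refl) = ∧-elimˡ h
  all-∈⁻ p {xs = y ∷ _} h (there x∈xs) = all-∈⁻ p (∧-elimʳ {p y} h) x∈xs

  ∈-keep⁺ : ∀ {A : Set} (p : A → Bool) {x} (xs : List A) → p x ≡ true → x ∈ xs → x ∈ keep p xs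
  ∈-keep⁺ p (y ∷ ys) px (here refl) rewrite px = here refl
  ∈-keep⁺ p (y ∷ ys) px (there x∈ys) with p y
  ... | true = there (∈-keep⁺ p ys px x∈ys)
  ... | false = ∈-keep⁺ p ys px x∈ys

  ∈-keep⁻ : ∀ {A : Set} (p : A → Bool) {x} (xs : List A) → x ∈ keep p xs → p x ≡ true × x ∈ xs
  ∈-keep⁻ p (y ∷ ys) x∈ with p y in py
  ∈-keep⁻ p (y ∷ ys) (here refl) | true = py , here refl
  ∈-keep⁻ p (y ∷ ys) (there x∈) | true = let px , x∈ys = ∈-keep⁻ p ys x∈ in px , there x∈ys
  ∈-keep⁻ p (y ∷ ys) x∈ | false = let px , x∈ys = ∈-keep⁻ p ys x∈ in px , there x∈ys

  search : ∀ {n} (p : Fin n → Bool) → (∃ λ x → p x ≡ true) ⊎ (∀ x → p x ≡ false)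
  search p with any? (λ x → p x ≟ᵇ true)
  ... | yes found = inj₁ found
  ... | no none = inj₂ λ x → ¬-not λ px → none (x , px)

  search-within : ∀ {n} (a p : Fin n → Bool) → (∃ λ x → a x ≡ true × p x ≡ false) ⊎ (∀ x → a x ≡ true → p x ≡ true)
  search-within a p with search (λ x → a x ∧ not (p x))
  ... | inj₁ (x , h) = inj₁ (x , ∧-elimˡ h , not-injective (∧-elimʳ {a x} h))
  ... | inj₂ none = inj₂ λ x ax → ¬-not λ px → true≢false (∧-intro ax (cong not px)) (none x)

  countFin : ∀ n → (Fin n → Bool) → ℕ
  countFin n p = sum λ i → if p i then 1 else 0

  count-tabulate : ∀ {A : Set} n (p : A → Bool) (f : Fin n → A) → count p (tabulate f) ≡ countFin n (p ∘ f)
  count-tabulate zero p f = refl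
  count-tabulate (suc n) p f with p (f zero)
  ... | true = cong suc (count-tabulate n p (f ∘ suc))
  ... | false = count-tabulate n p (f ∘ suc)

  count-allFin : ∀ n (p : Fin n → Bool) → count p (allFin n) ≡ countFin n p
  count-allFin n p = count-tabulate n p id

  countFin-cong : ∀ n {p q : Fin n → Bool} → (∀ x → p x ≡ q x) → countFin n p ≡ countFin n q
  countFin-cong zero h = refl
  countFin-cong (suc n) h rewrite h zero = cong (_ +_) (countFin-cong n (h ∘ suc))

  countFin-none : ∀ n {p : Fin n → Bool} → (∀ x → p x ≡ false) → countFin n p ≡ 0
  countFin-none zero h = refl
  countFin-none (suc n) h rewrite h zero = countFin-none n (h ∘ suc)

  countFin-except : ∀ n {p q : Fin n → Bool} (m : Fin n) → p m ≡ true → q m ≡ false →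
                    (∀ x → x ≢ m → p x ≡ q x) → countFin n p ≡ suc (countFin n q)
  countFin-except (suc n) zero pm qm h rewrite pm | qm = cong suc (countFin-cong n (λ x → h (suc x) λ ()))
  countFin-except (suc n) (suc m) pm qm h rewrite h zero (λ ()) =
    trans (cong (_ +_) (countFin-except n m pm qm (λ x x≢m → h (suc x) (x≢m ∘ suc-injective))))
          (+-suc _ _)

  countFin-remove : ∀ n (p : Fin n → Bool) m → p m ≡ true → countFin n p ≡ suc (countFin n (λ y → p y ∧ not (eqᵇ y m)))
  countFin-remove n p m pm = countFin-except n m pm (∧-falseʳ (cong not (eqᵇ-refl m))) agree
    where
      agree : ∀ x → x ≢ m → p x ≡ p x ∧ not (eqᵇ x m)
      agree x x≢m rewrite ≢⇒eqᵇ≡false x≢m = sym (∧-identityʳ (p x))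

  countFin-∨ : ∀ n {p q : Fin n → Bool} → (∀ x → p x ∧ q x ≡ false) →
               countFin n (λ x → p x ∨ q x) ≡ countFin n p + countFin n q
  countFin-∨ zero h = refl
  countFin-∨ (suc n) {p} {q} h with p zero in pz | q zero in qz
  ... | true | true = ⊥-elim (true≢false (∧-intro pz qz) (h zero))
  ... | true | false = cong suc (countFin-∨ n (h ∘ suc))
  ... | false | true = trans (cong suc (countFin-∨ n (h ∘ suc))) (sym (+-suc (countFin n (p ∘ suc)) _))
  ... | false | false = countFin-∨ n (h ∘ suc)

  countFin-mono : ∀ n {p q : Fin n → Bool} → (∀ x → p x ≡ true → q x ≡ true) → countFin n p ≤ countFin n q
  countFin-mono zero h = z≤n
  countFin-mono (suc n) {p} {q} h with p zero in pz | q zero in qz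
  ... | true | true = s≤s (countFin-mono n (h ∘ suc))
  ... | true | false = ⊥-elim (true≢false (h zero pz) qz)
  ... | false | true = ≤-trans (countFin-mono n (h ∘ suc)) (n≤1+n _)
  ... | false | false = countFin-mono n (h ∘ suc)

  countFin-mono-< : ∀ n {p q : Fin n → Bool} (m : Fin n) → (∀ x → p x ≡ true → q x ≡ true) →
                    p m ≡ false → q m ≡ true → countFin n p < countFin n q
  countFin-mono-< (suc n) zero h pm qm rewrite pm | qm = s≤s (countFin-mono n (h ∘ suc))
  countFin-mono-< (suc n) {p} {q} (suc m) h pm qm with p zero in pz | q zero in qz
  ... | true | true = s≤s (countFin-mono-< n m (h ∘ suc) pm qm)
  ... | true | false = ⊥-elim (true≢false (h zero pz) qz)
  ... | false | true = ≤-trans (countFin-mono-< n m (h ∘ suc) pm qm) (n≤1+n _)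
  ... | false | false = countFin-mono-< n m (h ∘ suc) pm qm

  countFin-involution : ∀ n (β : Fin n → Fin n) → (∀ x → β (β x) ≡ x) →
                        ∀ (p : Fin n → Bool) → countFin n (p ∘ β) ≡ countFin n p
  countFin-involution n β ββ p = sym (sum-permute (λ i → if p i then 1 else 0) (permutation β β ββ ββ))

  ⌊n+n/2⌋≡n : ∀ n → ⌊ n + n /2⌋ ≡ n
  ⌊n+n/2⌋≡n zero = refl
  ⌊n+n/2⌋≡n (suc n) rewrite +-suc n n = cong suc (⌊n+n/2⌋≡n n)

  least-witness : (P : ℕ → Bool) → ∀ h → P h ≡ true → ∃ λ j → j ≤ h × P j ≡ true × (∀ i → i < j → P i ≡ false)
  least-witness P zero P0 = 0 , z≤n , P0 , λ _ ()
  least-witness P (suc h) Psh with P 0 in P0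
  ... | true = 0 , z≤n , P0 , λ _ ()
  ... | false with least-witness (λ i → P (suc i)) h Psh
  ... | j , j≤h , Pj , before = suc j , s≤s j≤h , Pj , λ { zero _ → P0 ; (suc i) i<j → before i (s≤s⁻¹ i<j) }

  least-witness-unique : (P : ℕ → Bool) → ∀ j k → P j ≡ true → (∀ i → i < j → P i ≡ false) →
                         P k ≡ true → (∀ i → i < k → P i ≡ false) → j ≡ k
  least-witness-unique P j k Pj before-j Pk before-k with <-cmp j k
  ... | tri< j<k _ _ = ⊥-elim (true≢false Pj (before-k j j<k))
  ... | tri≈ _ j≡k _ = j≡k
  ... | tri> _ _ k<j = ⊥-elim (true≢false Pk (before-j k k<j))

  last-witness : (P : ℕ → Bool) → P 0 ≡ true → ∀ m →
                 ∃ λ k → k ≤ m × P k ≡ true × (∀ i → k < i → i ≤ m → P i ≡ false)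
  last-witness P P0 zero = 0 , z≤n , P0 , λ { _ () z≤n }
  last-witness P P0 (suc m) with P (suc m) in Psm
  ... | true = suc m , ≤-refl , Psm , λ i sm<i i≤sm → ⊥-elim (<-irrefl refl (≤-trans sm<i i≤sm))
  ... | false with last-witness P P0 m
  ... | k , k≤m , Pk , after = k , m≤n⇒m≤1+n k≤m , Pk , after′
    where
      after′ : ∀ i → k < i → i ≤ suc m → P i ≡ false
      after′ i k<i i≤sm with m≤n⇒m<n∨m≡n i≤sm
      ... | inj₁ i<sm = after i k<i (s≤s⁻¹ i<sm)
      ... | inj₂ refl = Psm

  Unique-keep : ∀ {A : Set} (p : A → Bool) {xs : List A} → Unique xs → Unique (keep p xs)
  Unique-keep p [] = []
  Unique-keep p {x ∷ xs} (x∉xs ∷ uniq) with p x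
  ... | true = All.tabulate (λ y∈ → All.lookup x∉xs (proj₂ (∈-keep⁻ p xs y∈))) ∷ Unique-keep p uniq
  ... | false = Unique-keep p uniq

  sublists-⊆ : ∀ {A : Set} (L : List A) {S} → S ∈ sublists L → ∀ {a} → a ∈ S → a ∈ L
  sublists-⊆ [] (here refl) ()
  sublists-⊆ (x ∷ xs) S∈ a∈S with ∈-++⁻ (sublists xs) S∈
  ... | inj₁ S∈′ = there (sublists-⊆ xs S∈′ a∈S)
  ... | inj₂ S∈′ with ∈-map⁻ (x ∷_) S∈′
  ... | S′ , S′∈ , refl with a∈S
  ... | here refl = here refl
  ... | there a∈S′ = there (sublists-⊆ xs S′∈ a∈S′)

  module Transversal {n : ℕ} (R : Fin n → Fin n → Bool) where

    record EquivalenceOn (S : Fin n → Bool) : Set where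
      field
        refl′  : ∀ x → S x ≡ true → R x x ≡ true
        sym′   : ∀ x y → S x ≡ true → R x y ≡ true → R y x ≡ true
        trans′ : ∀ x y z → S x ≡ true → R x y ≡ true → R y z ≡ true → R x z ≡ true
        closed : ∀ x y → S x ≡ true → R x y ≡ true → S y ≡ true

    IsTransversal : (P S : Fin n → Bool) → Set
    IsTransversal P S = (∀ x → S x ≡ true → ∃ λ y → R x y ≡ true × P y ≡ true)
                      × (∀ y y′ → S y ≡ true → P y ≡ true → P y′ ≡ true → R y y′ ≡ true → y ≡ y′)

    module _ {S : Fin n → Bool} (E : EquivalenceOn S) (x₀ : Fin n) (Sx₀ : S x₀ ≡ true) where
      open EquivalenceOn E

      withoutClass : Fin n → Bool
      withoutClass y = S y ∧ not (R x₀ y)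

      leaves-class : ∀ x y → S x ≡ true → R x₀ x ≡ false → R x y ≡ true → R x₀ y ≡ false
      leaves-class x y Sx x₀x xy = ¬-not λ x₀y → true≢false (trans′ x₀ y x Sx₀ x₀y (sym′ x y Sx xy)) x₀x

      withoutClass-equivalence : EquivalenceOn withoutClass
      withoutClass-equivalence = record
        { refl′ = λ x s → refl′ x (∧-elimˡ s)
        ; sym′ = λ x y s → sym′ x y (∧-elimˡ s)
        ; trans′ = λ x y z s → trans′ x y z (∧-elimˡ s)
        ; closed = λ x y s xy → ∧-intro (closed x y (∧-elimˡ s) xy)
                                        (cong not (leaves-class x y (∧-elimˡ s) (not-injective (∧-elimʳ {S x} s)) xy)) }

      withoutClass-transversal : ∀ {P} → IsTransversal P S → IsTransversal P withoutClass
      withoutClass-transversal (exists , unique) = (λ x → exists x ∘ ∧-elimˡ) , (λ y y′ → unique y y′ ∘ ∧-elimˡ)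

      count-withoutClass : ∀ {P} → IsTransversal P S →
                           countFin n (λ x → S x ∧ P x) ≡ suc (countFin n (λ x → withoutClass x ∧ P x))
      count-withoutClass {P} (exists , unique) with exists x₀ Sx₀
      ... | y₀ , x₀y₀ , Py₀ =
        countFin-except n y₀ (∧-intro Sy₀ Py₀) (cong (_∧ P y₀) (∧-falseʳ (cong not x₀y₀))) agree
        where
          Sy₀ = closed x₀ y₀ Sx₀ x₀y₀
          agree : ∀ x → x ≢ y₀ → S x ∧ P x ≡ withoutClass x ∧ P x
          agree x x≢y₀ with S x in Sx | R x₀ x in x₀x | P x in Px
          ... | false | _ | _ = refl
          ... | true | false | _ = refl
          ... | true | true | false = refl
          ... | true | true | true =
            ⊥-elim (x≢y₀ (unique x y₀ Sx Px Py₀ (trans′ x x₀ y₀ Sx (sym′ x₀ x Sx₀ x₀x) x₀y₀)))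

    count-transversal : ∀ {S} → EquivalenceOn S → ∀ {P Q} → IsTransversal P S → IsTransversal Q S →
                        countFin n (λ x → S x ∧ P x) ≡ countFin n (λ x → S x ∧ Q x)
    count-transversal {S} E = go (countFin n S) ≤-refl E
      where
        go : ∀ k {S} → countFin n S ≤ k → EquivalenceOn S → ∀ {P Q} → IsTransversal P S → IsTransversal Q S →
             countFin n (λ x → S x ∧ P x) ≡ countFin n (λ x → S x ∧ Q x)
        go k {S} bound E TP TQ with search S
        ... | inj₂ empty = trans (countFin-none n (λ x → cong (_∧ _) (empty x)))
                                 (sym (countFin-none n (λ x → cong (_∧ _) (empty x))))
        go zero bound E TP TQ | inj₁ (x₀ , Sx₀) with ≤-trans (countFin-mono-< n x₀ (λ _ ()) refl Sx₀) bound
        ... | ()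
        go (suc k) {S} bound E TP TQ | inj₁ (x₀ , Sx₀) =
          trans (count-withoutClass E x₀ Sx₀ TP)
            (trans (cong suc (go k smaller (withoutClass-equivalence E x₀ Sx₀)
                                  (withoutClass-transversal E x₀ Sx₀ TP) (withoutClass-transversal E x₀ Sx₀ TQ)))
                   (sym (count-withoutClass E x₀ Sx₀ TQ)))
          where
            open EquivalenceOn E
            smaller : countFin n (withoutClass E x₀ Sx₀) ≤ k
            smaller with ≤-trans (countFin-mono-< n x₀ (λ x → ∧-elimˡ) (∧-falseʳ (cong not (refl′ x₀ Sx₀))) Sx₀) bound
            ... | s≤s p = p

    IsMinimal : Fin n → Set
    IsMinimal x = ∀ y → R x y ≡ true → toℕ x ≤ toℕ y

    module _ {S : Fin n → Bool} (E : EquivalenceOn S) where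
      open EquivalenceOn E

      minimal-exists : ∀ x → S x ≡ true → ∃ λ m → R x m ≡ true × IsMinimal m
      minimal-exists x₀ Sx₀ = go (suc (toℕ x₀)) x₀ ≤-refl Sx₀
        where
          go : ∀ k x → toℕ x < k → S x ≡ true → ∃ λ m → R x m ≡ true × IsMinimal m
          go (suc k) x (s≤s x<k) Sx with search (λ y → R x y ∧ (toℕ y <ᵇ toℕ x))
          ... | inj₁ (y , xy∧y<x) =
            let m , ym , min = go k y (<-≤-trans (<ᵇ≡true⇒< (∧-elimʳ xy∧y<x)) x<k) (closed x y Sx (∧-elimˡ xy∧y<x))
            in m , trans′ x y m Sx (∧-elimˡ xy∧y<x) ym , min
          ... | inj₂ none = x , refl′ x Sx , λ y xy → ≮⇒≥ λ y<x →
            true≢false (∧-intro xy (<⇒<ᵇ≡true y<x)) (none y)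

      minimal-transversal : (P : Fin n → Bool) → (∀ y → S y ≡ true → P y ≡ true → IsMinimal y) →
                            (∀ y → S y ≡ true → IsMinimal y → P y ≡ true) → IsTransversal P S
      minimal-transversal P P⇒min min⇒P =
        (λ x Sx → let m , xm , min = minimal-exists x Sx in m , xm , min⇒P m (closed x m Sx xm) min) ,
        (λ y y′ Sy Py Py′ yy′ → toℕ-injective (≤-antisym (P⇒min y Sy Py y′ yy′)
            (P⇒min y′ (closed y y′ Sy yy′) Py′ y (sym′ y y′ Sy yy′))))

module Orbits where

  open Counting
  open import Data.Nat.Base using (zero; suc; _+_; _*_; s≤s⁻¹; _≤ᵇ_)
  open import Data.Nat.Properties using (≤-refl; ≤-trans; n≤1+n; m+[n∸m]≡n; m∸n≤m; m<n⇒0<n∸m; <⇒≤)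
  open import Data.Nat.DivMod using (_%_; _/_; m≡m%n+[m/n]*n; m%n<n)
  open import Data.Fin.Base using (toℕ)
  open import Data.Fin.Properties using (pigeonhole; toℕ<n)
  open import Data.List.Base using ([]; _∷_; upTo)
  open import Data.List.Properties using (concatMap-cong)
  open import Data.List.Membership.Propositional using (find; lose)
  open import Data.List.Membership.Propositional.Properties using (∈-upTo⁺; ∈-concatMap⁺; ∈-concatMap⁻)
  open import Data.List.Relation.Unary.Any using (here; there)
  open import Data.Product using (∃; _×_; _,_)
  open import Data.Sum using (_⊎_; inj₁; inj₂)
  open import Relation.Binary.PropositionalEquality

  iter-+ : ∀ {A : Set} j k (f : A → A) x → iter (j + k) f x ≡ iter j f (iter k f x)
  iter-+ zero k f x = refl
  iter-+ (suc j) k f x = cong f (iter-+ j k f x)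

  iter-cong : ∀ {A : Set} k {f g : A → A} x → (∀ y → f y ≡ g y) → iter k f x ≡ iter k g x
  iter-cong zero x f≗g = refl
  iter-cong (suc k) {g = g} x f≗g = trans (f≗g _) (cong g (iter-cong k x f≗g))

  orbit-cong : ∀ {n} (α : Fin n → Fin n) {β β′ : Fin n → Fin n} → (∀ x → β x ≡ β′ x) → ∀ x → orbit α β x ≡ orbit α β′ x
  orbit-cong {n} α {β} {β′} β≗β′ x =
    concatMap-cong (λ k → cong₂ (λ y z → y ∷ z ∷ []) (same-walk k) (trans (β≗β′ _) (cong β′ (same-walk k)))) (upTo (suc n))
    where
      same-walk : ∀ k → iter k (λ z → α (β z)) x ≡ iter k (λ z → α (β′ z)) x
      same-walk k = iter-cong k x (λ z → cong α (β≗β′ z))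

  module _ {n : ℕ} (α β : Fin n → Fin n) where

    isRep⇒minimal : ∀ x → isRep α β x ≡ true → Transversal.IsMinimal (sameOrbit α β) x
    isRep⇒minimal x rep y xy with any-∈⁻ (eqᵇ y) (orbit α β x) xy
    ... | z , z∈orbit , y≡z rewrite eqᵇ⇒≡ y≡z = ≤ᵇ≡true⇒≤ (all-∈⁻ (λ y → toℕ x ≤ᵇ toℕ y) rep z∈orbit)

    minimal⇒isRep : ∀ x → Transversal.IsMinimal (sameOrbit α β) x → isRep α β x ≡ true
    minimal⇒isRep x min = all-∈⁺ (λ y → toℕ x ≤ᵇ toℕ y) (orbit α β x)
      (λ y y∈orbit → ≤⇒≤ᵇ≡true (min y (any-∈⁺ (eqᵇ y) y∈orbit (eqᵇ-refl y))))

  isRep-cong : ∀ {n} {α β α′ β′ : Fin n → Fin n} x →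
               (∀ y → sameOrbit α β x y ≡ true → sameOrbit α′ β′ x y ≡ true) →
               (∀ y → sameOrbit α′ β′ x y ≡ true → sameOrbit α β x y ≡ true) → isRep α β x ≡ isRep α′ β′ x
  isRep-cong {α = α} {β} {α′} {β′} x to from =
    ⇔⇒≡ (λ rep → minimal⇒isRep α′ β′ x (λ y xy → isRep⇒minimal α β x rep y (from y xy)))
        (λ rep → minimal⇒isRep α β x (λ y xy → isRep⇒minimal α′ β′ x rep y (to y xy)))

  module DihedralOrbits {n : ℕ} (α β : Fin n → Fin n) (S : Fin n → Bool)
    (α-closed : ∀ x → S x ≡ true → S (α x) ≡ true) (β-closed : ∀ x → S x ≡ true → S (β x) ≡ true)
    (α-invol : ∀ x → S x ≡ true → α (α x) ≡ x) (β-invol : ∀ x → S x ≡ true → β (β x) ≡ x) where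

    step : Fin n → Fin n
    step z = α (β z)

    walk : ℕ → Fin n → Fin n
    walk k = iter k step

    walk-closed : ∀ k x → S x ≡ true → S (walk k x) ≡ true
    walk-closed zero x Sx = Sx
    walk-closed (suc k) x Sx = α-closed _ (β-closed _ (walk-closed k x Sx))

    walk-cancel : ∀ k x y → S x ≡ true → S y ≡ true → walk k x ≡ walk k y → x ≡ y
    walk-cancel zero x y Sx Sy eq = eq
    walk-cancel (suc k) x y Sx Sy eq = walk-cancel k x y Sx Sy step-injective
      where
        x′ = walk k x
        y′ = walk k y
        Sx′ = walk-closed k x Sx
        Sy′ = walk-closed k y Sy
        step-injective : x′ ≡ y′
        step-injective = begin
          x′               ≡⟨ β-invol x′ Sx′ ⟨
          β (β x′)         ≡⟨ cong β (α-invol _ (β-closed x′ Sx′)) ⟨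
          β (α (α (β x′))) ≡⟨ cong (λ z → β (α z)) eq ⟩
          β (α (α (β y′))) ≡⟨ cong β (α-invol _ (β-closed y′ Sy′)) ⟩
          β (β y′)         ≡⟨ β-invol y′ Sy′ ⟩
          y′               ∎
          where open ≡-Reasoning

    -- `orbit` only lists the first n + 1 steps of the walk; a period of at most n makes that enough.
    walk-period : ∀ x → S x ≡ true → ∃ λ p → walk (suc p) x ≡ x × suc p ≤ n
    walk-period x Sx with pigeonhole ≤-refl (λ (i : Fin (suc n)) → walk (toℕ i) x)
    ... | i , j , i<j , eq with toℕ j ∸ toℕ i in d≡j∸i | m<n⇒0<n∸m i<j
    ... | suc p | _ = p , returns , period≤n
      where
        returns : walk (suc p) x ≡ x
        returns = sym (walk-cancel (toℕ i) x (walk (suc p) x) Sx (walk-closed (suc p) x Sx)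
          (trans eq (trans (cong (λ m → walk m x) (trans (sym (m+[n∸m]≡n (<⇒≤ i<j))) (cong (toℕ i +_) d≡j∸i)))
                           (iter-+ (toℕ i) (suc p) step x))))
        period≤n : suc p ≤ n
        period≤n = subst (_≤ n) d≡j∸i (≤-trans (m∸n≤m (toℕ j) (toℕ i)) (s≤s⁻¹ (toℕ<n j)))

    walk-mod : ∀ x p → walk (suc p) x ≡ x → ∀ k → walk k x ≡ walk (k % suc p) x
    walk-mod x p returns k = trans (cong (λ m → walk m x) (m≡m%n+[m/n]*n k (suc p)))
      (trans (iter-+ (k % suc p) (k / suc p * suc p) step x) (cong (walk (k % suc p)) (periodic (k / suc p))))
      where
        periodic : ∀ q → walk (q * suc p) x ≡ x
        periodic zero = refl
        periodic (suc q) = trans (iter-+ (suc p) (q * suc p) step x) (trans (cong (walk (suc p)) (periodic q)) returns)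

    Reach : Fin n → Fin n → Set
    Reach x y = ∃ λ k → y ≡ walk k x ⊎ y ≡ β (walk k x)

    private
      pair : Fin n → ℕ → List (Fin n)
      pair x k = walk k x ∷ β (walk k x) ∷ []

    sameOrbit⇒Reach : ∀ x y → sameOrbit α β x y ≡ true → Reach x y
    sameOrbit⇒Reach x y h with any-∈⁻ (eqᵇ y) (orbit α β x) h
    ... | z , z∈orbit , y≡z with eqᵇ⇒≡ y≡z | find (∈-concatMap⁻ (pair x) {xs = upTo (suc n)} z∈orbit)
    ... | refl | k , _ , here y≡ = k , inj₁ y≡
    ... | refl | k , _ , there (here y≡) = k , inj₂ y≡

    Reach⇒sameOrbit : ∀ x y → S x ≡ true → Reach x y → sameOrbit α β x y ≡ true
    Reach⇒sameOrbit x y Sx (k , y∈pair) with walk-period x Sx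
    ... | p , returns , period≤n =
      any-∈⁺ (eqᵇ y) (∈-concatMap⁺ (pair x) (lose (∈-upTo⁺ (≤-trans (m%n<n k (suc p)) (≤-trans period≤n (n≤1+n n))))
                                         (member y∈pair)))
             (eqᵇ-refl y)
      where
        member : (y ≡ walk k x ⊎ y ≡ β (walk k x)) → y ∈ pair x (k % suc p)
        member (inj₁ refl) = here (walk-mod x p returns k)
        member (inj₂ refl) = there (here (cong β (walk-mod x p returns k)))

    Reach-closed : ∀ x y → S x ≡ true → Reach x y → S y ≡ true
    Reach-closed x y Sx (k , inj₁ refl) = walk-closed k x Sx
    Reach-closed x y Sx (k , inj₂ refl) = β-closed _ (walk-closed k x Sx)

    Reach-β : ∀ x y → S x ≡ true → Reach x y → Reach x (β y)
    Reach-β x y Sx (k , inj₁ refl) = k , inj₂ refl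
    Reach-β x y Sx (k , inj₂ refl) = k , inj₁ (β-invol _ (walk-closed k x Sx))

    Reach-α : ∀ x y → S x ≡ true → Reach x y → Reach x (α y)
    Reach-α x y Sx (zero , inj₁ refl) with walk-period x Sx
    ... | p , returns , _ = p , inj₂ (trans (cong α (sym returns)) (α-invol _ (β-closed _ (walk-closed p x Sx))))
    Reach-α x y Sx (suc k , inj₁ refl) = k , inj₂ (α-invol _ (β-closed _ (walk-closed k x Sx)))
    Reach-α x y Sx (k , inj₂ refl) = suc k , inj₁ refl

    Reach-walk : ∀ x y → S x ≡ true → Reach x y → ∀ k → Reach x (walk k y)
    Reach-walk x y Sx xy zero = xy
    Reach-walk x y Sx xy (suc k) = Reach-α x _ Sx (Reach-β x _ Sx (Reach-walk x y Sx xy k))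

    Reach-trans : ∀ x y z → S x ≡ true → Reach x y → Reach y z → Reach x z
    Reach-trans x y z Sx xy (k , inj₁ refl) = Reach-walk x y Sx xy k
    Reach-trans x y z Sx xy (k , inj₂ refl) = Reach-β x _ Sx (Reach-walk x y Sx xy k)

    Reach-refl : ∀ x → Reach x x
    Reach-refl x = 0 , inj₁ refl

    Reach-walk⁻ : ∀ x k → S x ≡ true → Reach (walk k x) x
    Reach-walk⁻ x zero Sx = Reach-refl x
    Reach-walk⁻ x (suc k) Sx = Reach-trans w (walk k x) x Sw back (Reach-walk⁻ x k Sx)
      where
        w = walk (suc k) x
        Sw = walk-closed (suc k) x Sx
        Swk = walk-closed k x Sx
        back : Reach w (walk k x)
        back = subst (Reach w) (trans (cong β (α-invol _ (β-closed _ Swk))) (β-invol _ Swk))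
                     (Reach-β w _ Sw (Reach-α w w Sw (Reach-refl w)))

    Reach-sym : ∀ x y → S x ≡ true → Reach x y → Reach y x
    Reach-sym x y Sx (k , inj₁ refl) = Reach-walk⁻ x k Sx
    Reach-sym x y Sx (k , inj₂ refl) =
      Reach-trans _ _ x (β-closed _ (walk-closed k x Sx)) (0 , inj₂ (sym (β-invol _ (walk-closed k x Sx))))
                  (Reach-walk⁻ x k Sx)

    sameOrbit-refl : ∀ x → S x ≡ true → sameOrbit α β x x ≡ true
    sameOrbit-refl x Sx = Reach⇒sameOrbit x x Sx (Reach-refl x)

    sameOrbit-closed : ∀ x y → S x ≡ true → sameOrbit α β x y ≡ true → S y ≡ true
    sameOrbit-closed x y Sx xy = Reach-closed x y Sx (sameOrbit⇒Reach x y xy)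

    sameOrbit-sym : ∀ x y → S x ≡ true → sameOrbit α β x y ≡ true → sameOrbit α β y x ≡ true
    sameOrbit-sym x y Sx xy =
      Reach⇒sameOrbit y x (sameOrbit-closed x y Sx xy) (Reach-sym x y Sx (sameOrbit⇒Reach x y xy))

    sameOrbit-trans : ∀ x y z → S x ≡ true → sameOrbit α β x y ≡ true → sameOrbit α β y z ≡ true →
                      sameOrbit α β x z ≡ true
    sameOrbit-trans x y z Sx xy yz =
      Reach⇒sameOrbit x z Sx (Reach-trans x y z Sx (sameOrbit⇒Reach x y xy) (sameOrbit⇒Reach y z yz))

    sameOrbit-α : ∀ x y → S x ≡ true → sameOrbit α β x y ≡ true → sameOrbit α β x (α y) ≡ true
    sameOrbit-α x y Sx xy = Reach⇒sameOrbit x _ Sx (Reach-α x y Sx (sameOrbit⇒Reach x y xy))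

    sameOrbit-β : ∀ x y → S x ≡ true → sameOrbit α β x y ≡ true → sameOrbit α β x (β y) ≡ true
    sameOrbit-β x y Sx xy = Reach⇒sameOrbit x _ Sx (Reach-β x y Sx (sameOrbit⇒Reach x y xy))

    sameOrbit-equivalence : Transversal.EquivalenceOn (sameOrbit α β) S
    sameOrbit-equivalence = record
      { refl′ = sameOrbit-refl ; sym′ = sameOrbit-sym ; trans′ = sameOrbit-trans ; closed = sameOrbit-closed }

    sameOrbit-ind : ∀ x (Q : Fin n → Set) → S x ≡ true → Q x →
                    (∀ y → S y ≡ true → Q y → Q (α y)) → (∀ y → S y ≡ true → Q y → Q (β y)) →
                    ∀ y → sameOrbit α β x y ≡ true → Q y
    sameOrbit-ind x Q Sx Qx Qα Qβ y xy = on-Reach (sameOrbit⇒Reach x y xy)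
      where
        Q-walk : ∀ k → Q (walk k x)
        Q-walk zero = Qx
        Q-walk (suc k) = Qα _ (β-closed _ (walk-closed k x Sx)) (Qβ _ (walk-closed k x Sx) (Q-walk k))
        on-Reach : ∀ {y} → Reach x y → Q y
        on-Reach (k , inj₁ refl) = Q-walk k
        on-Reach (k , inj₂ refl) = Qβ _ (walk-closed k x Sx) (Q-walk k)

    isRep-transversal : Transversal.IsTransversal (sameOrbit α β) (isRep α β) S
    isRep-transversal = Transversal.minimal-transversal (sameOrbit α β) sameOrbit-equivalence (isRep α β)
      (λ y _ → isRep⇒minimal α β y) (λ y _ → minimal⇒isRep α β y)

-- One step of `deleteHE`: S are the surviving vertices, γ their current g-colouring, E the hyperedge
-- being deleted and τ a graph state that agrees with r on E. The new g-colouring γ′ leaves each vertex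
-- of S′ = S \ E along the γ–r path through E. Each ⟨γ,τ⟩-orbit either meets S′, where it becomes a
-- ⟨γ′,τ⟩-orbit, or lies inside E, where it is a ⟨γ,r⟩-cycle that `deleteHE` turns into an isolate.
module CycleDeletion {n : ℕ} (S E : Fin n → Bool) (γ τ r : Fin n → Fin n)
  (γ-closed : ∀ x → S x ≡ true → S (γ x) ≡ true) (γ-invol : ∀ x → S x ≡ true → γ (γ x) ≡ x)
  (τ-closed : ∀ x → S x ≡ true → S (τ x) ≡ true) (τ-invol : ∀ x → S x ≡ true → τ (τ x) ≡ x)
  (r-closed : ∀ x → S x ≡ true → S (r x) ≡ true) (r-invol : ∀ x → S x ≡ true → r (r x) ≡ x)
  (E-r : ∀ x → S x ≡ true → E (r x) ≡ E x) (E-τ : ∀ x → S x ≡ true → E (τ x) ≡ E x)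
  (τ≡r-on-E : ∀ x → S x ≡ true → E x ≡ true → τ x ≡ r x) where
  open Counting
  open Orbits
  open import Data.Nat.Base using (zero; suc; _+_; _<_; z≤n; s≤s)
  open import Data.Nat.Properties
    using (≤-refl; ≤-trans; <⇒≤; +-suc; +-identityʳ; m≤n⇒m≤1+n; m≤n⇒∃[o]m+o≡n; +-monoʳ-<; m≤m+n; +-comm)
  open import Data.Nat.Induction using (<-wellFounded)
  open import Induction.WellFounded using (Acc; acc)
  open import Data.Bool.Base using (false; _∧_; _∨_; not)
  open import Data.Bool.Properties using (¬-not; not-injective)
  open import Data.Bool.ListAction using (all)
  open import Data.Product using (∃; _×_; _,_; proj₁; proj₂)
  open import Data.Sum using (inj₁; inj₂)
  open import Data.Empty using (⊥-elim)
  open import Relation.Binary.PropositionalEquality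

  S′ : Fin n → Bool
  S′ x = S x ∧ not (E x)

  γ′ : Fin n → Fin n
  γ′ z = chase S′ γ r n (γ z)

  module γr = DihedralOrbits γ r S γ-closed r-closed γ-invol r-invol
  module γτ = DihedralOrbits γ τ S γ-closed τ-closed γ-invol τ-invol

  detour : Fin n → ℕ → Fin n
  detour z i = γr.walk i (γ z)

  S′⇒S : ∀ {x} → S′ x ≡ true → S x ≡ true
  S′⇒S = ∧-elimˡ

  S′⇒¬E : ∀ {x} → S′ x ≡ true → E x ≡ false
  S′⇒¬E {x} h = not-injective (∧-elimʳ {S x} h)

  ¬S′⇒E : ∀ {x} → S x ≡ true → S′ x ≡ false → E x ≡ true
  ¬S′⇒E {x} Sx h = ¬-not λ Ex → true≢false (∧-intro Sx (cong not Ex)) h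

  E⇒¬S′ : ∀ {x} → E x ≡ true → S′ x ≡ false
  E⇒¬S′ Ex = ∧-falseʳ (cong not Ex)

  S′-intro : ∀ {x} → S x ≡ true → E x ≡ false → S′ x ≡ true
  S′-intro Sx ¬Ex = ∧-intro Sx (cong not ¬Ex)

  τ-closed′ : ∀ x → S′ x ≡ true → S′ (τ x) ≡ true
  τ-closed′ x h = S′-intro (τ-closed x (S′⇒S h)) (trans (E-τ x (S′⇒S h)) (S′⇒¬E h))

  detour-closed : ∀ z → S z ≡ true → ∀ i → S (detour z i) ≡ true
  detour-closed z Sz i = γr.walk-closed i (γ z) (γ-closed z Sz)

  chase≡detour : ∀ fuel j y → j ≤ fuel → (∀ i → i < j → S′ (γr.walk i y) ≡ false) →
                 S′ (γr.walk j y) ≡ true → chase S′ γ r fuel y ≡ γr.walk j y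
  chase≡detour zero zero y _ _ hit = refl
  chase≡detour (suc fuel) zero y _ _ hit rewrite hit = refl
  chase≡detour (suc fuel) (suc j) y (s≤s j≤fuel) before hit rewrite before 0 (s≤s z≤n) =
    trans (chase≡detour fuel j (γ (r y)) j≤fuel (λ i i<j → trans (cong S′ (shift i)) (before (suc i) (s≤s i<j)))
                        (trans (cong S′ (shift j)) hit))
          (shift j)
    where
      shift : ∀ i → γr.walk i (γ (r y)) ≡ γr.walk (suc i) y
      shift zero = refl
      shift (suc i) = cong γr.step (shift i)

  detour-reaches-S′ : ∀ z → S′ z ≡ true → ∃ λ p → p < n × S′ (detour z p) ≡ true
  detour-reaches-S′ z h with γr.walk-period (γ z) (γ-closed z (S′⇒S h))
  ... | p , returns , p<n =
    p , p<n , subst (λ w → S′ w ≡ true) (sym detour≡rz) (S′-intro (r-closed z Sz) (trans (E-r z Sz) (S′⇒¬E h)))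
    where
      Sz = S′⇒S h
      Sp = detour-closed z Sz p
      detour≡rz : detour z p ≡ r z
      detour≡rz = begin
        detour z p               ≡⟨ r-invol _ Sp ⟨
        r (r (detour z p))       ≡⟨ cong r (γ-invol _ (r-closed _ Sp)) ⟨
        r (γ (γ (r (detour z p)))) ≡⟨ cong (λ w → r (γ w)) returns ⟩
        r (γ (γ z))              ≡⟨ cong r (γ-invol z Sz) ⟩
        r z                      ∎
        where open ≡-Reasoning

  γ′≡first-hit : ∀ z → S′ z ≡ true → ∀ j → S′ (detour z j) ≡ true → (∀ i → i < j → S′ (detour z i) ≡ false) →
                 γ′ z ≡ detour z j
  γ′≡first-hit z h j hit before with detour-reaches-S′ z h
  ... | p , p<n , hit-p with least-witness (λ i → S′ (detour z i)) p hit-p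
  ... | j₀ , j₀≤p , hit₀ , before₀ with least-witness-unique (λ i → S′ (detour z i)) j j₀ hit before hit₀ before₀
  ... | refl = chase≡detour n j (γ z) (≤-trans j₀≤p (<⇒≤ p<n)) before hit

  γ′-first-hit : ∀ z → S′ z ≡ true →
                 ∃ λ j → S′ (detour z j) ≡ true × (∀ i → i < j → S′ (detour z i) ≡ false) × γ′ z ≡ detour z j
  γ′-first-hit z h with detour-reaches-S′ z h
  ... | p , _ , hit-p with least-witness (λ i → S′ (detour z i)) p hit-p
  ... | j , _ , hit , before = j , hit , before , γ′≡first-hit z h j hit before

  γ′-closed : ∀ z → S′ z ≡ true → S′ (γ′ z) ≡ true
  γ′-closed z h with γ′-first-hit z h
  ... | j , hit , _ , γ′z≡ rewrite γ′z≡ = hit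

  detour-reverse : ∀ z → S z ≡ true → ∀ j i k → i + k ≡ j → γr.walk i (γ (detour z j)) ≡ γ (detour z k)
  detour-reverse z Sz j zero k refl = refl
  detour-reverse z Sz j (suc i) k i+k≡j =
    trans (cong γr.step (detour-reverse z Sz j i (suc k) (trans (+-suc i k) i+k≡j)))
          (trans (cong (λ w → γ (r w)) (γ-invol _ (r-closed _ Sk))) (cong γ (r-invol _ Sk)))
    where Sk = detour-closed z Sz k

  -- The detour from γ′ z retraces the detour from z backwards.
  γ′-invol : ∀ z → S′ z ≡ true → γ′ (γ′ z) ≡ z
  γ′-invol z h with γ′-first-hit z h
  ... | j , hit , before , γ′z≡ rewrite γ′z≡ =
    trans (γ′≡first-hit w hit j (subst (λ v → S′ v ≡ true) (sym (trans back (γ-invol z Sz))) h) before-back)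
          (trans back (γ-invol z Sz))
    where
      Sz = S′⇒S h
      w = detour z j
      back : detour w j ≡ γ (detour z 0)
      back = detour-reverse z Sz j j 0 (+-identityʳ j)
      before-back : ∀ i → i < j → S′ (detour w i) ≡ false
      before-back i i<j with m≤n⇒∃[o]m+o≡n i<j
      ... | k , i+1+k≡j = subst (λ v → S′ v ≡ false)
          (sym (detour-reverse z Sz j i (suc k) (trans (+-suc i k) i+1+k≡j)))
          (subst (λ v → S′ v ≡ false) (sym (γ-invol _ (r-closed _ Sk)))
            (E⇒¬S′ (trans (E-r _ Sk) (¬S′⇒E Sk (before k k<j)))))
        where
          Sk = detour-closed z Sz k
          k<j : k < j
          k<j = subst (k <_) i+1+k≡j (s≤s (subst (k ≤_) (+-comm k i) (m≤m+n k i)))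

  module γ′τ = DihedralOrbits γ′ τ S′ γ′-closed τ-closed′ γ′-invol (λ x h → τ-invol x (S′⇒S h))

  γτ-orbit-along-detour : ∀ x → S x ≡ true → ∀ y → sameOrbit γ τ x y ≡ true → ∀ i →
                          (∀ i′ → i′ < i → E (detour y i′) ≡ true) → sameOrbit γ τ x (detour y i) ≡ true
  γτ-orbit-along-detour x Sx y xy zero _ = γτ.sameOrbit-α x y Sx xy
  γτ-orbit-along-detour x Sx y xy (suc i) in-E =
    subst (λ v → sameOrbit γ τ x (γ v) ≡ true) (τ≡r-on-E _ (γτ.sameOrbit-closed x _ Sx x~yi) (in-E i ≤-refl))
          (γτ.sameOrbit-α x _ Sx (γτ.sameOrbit-β x _ Sx x~yi))
    where x~yi = γτ-orbit-along-detour x Sx y xy i (λ i′ i′<i → in-E i′ (m≤n⇒m≤1+n i′<i))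

  γ′τ⇒γτ : ∀ x → S′ x ≡ true → ∀ y → sameOrbit γ′ τ x y ≡ true → sameOrbit γ τ x y ≡ true
  γ′τ⇒γτ x Sx′ = γ′τ.sameOrbit-ind x (λ y → sameOrbit γ τ x y ≡ true) Sx′ (γτ.sameOrbit-refl x Sx) γ′-step
                   (λ y _ → γτ.sameOrbit-β x y Sx)
    where
      Sx = S′⇒S Sx′
      γ′-step : ∀ y → S′ y ≡ true → sameOrbit γ τ x y ≡ true → sameOrbit γ τ x (γ′ y) ≡ true
      γ′-step y Sy′ xy with γ′-first-hit y Sy′
      ... | j , _ , before , γ′y≡ rewrite γ′y≡ =
        γτ-orbit-along-detour x Sx y xy j (λ i i<j → ¬S′⇒E (detour-closed y (S′⇒S Sy′) i) (before i i<j))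

  module _ (x : Fin n) (Sx′ : S′ x ≡ true) where
    private
      c : ℕ → Fin n
      c k = γτ.walk k x
      Sc : ∀ k → S (c k) ≡ true
      Sc k = γτ.walk-closed k x (S′⇒S Sx′)

    detour-follows-walk : ∀ k i → (∀ i′ → i′ < i → E (c (suc k + i′)) ≡ true) → detour (τ (c k)) i ≡ c (suc k + i)
    detour-follows-walk k zero _ = cong (λ m → c (suc m)) (sym (+-identityʳ k))
    detour-follows-walk k (suc i) in-E =
      trans (cong γr.step (detour-follows-walk k i (λ i′ i′<i → in-E i′ (m≤n⇒m≤1+n i′<i))))
            (trans (cong γ (sym (τ≡r-on-E _ (Sc (suc k + i)) (in-E i ≤-refl)))) (cong c (sym (+-suc (suc k) i))))

    γ′-skips-E : ∀ k m → k ≤ m → S′ (c k) ≡ true → (∀ i → k < i → i ≤ m → S′ (c i) ≡ false) →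
                 S′ (c (suc m)) ≡ true → γ′ (τ (c k)) ≡ c (suc m)
    γ′-skips-E k m k≤m Sck′ gap hit with m≤n⇒∃[o]m+o≡n k≤m
    ... | j , refl = trans (γ′≡first-hit (τ (c k)) (τ-closed′ _ Sck′) j hit′ before) (follows j ≤-refl)
      where
        in-gap : ∀ i → i < j → S′ (c (suc k + i)) ≡ false
        in-gap i i<j = gap (suc k + i) (s≤s (m≤m+n k i)) (+-monoʳ-< k i<j)
        follows : ∀ i → i ≤ j → detour (τ (c k)) i ≡ c (suc k + i)
        follows i i≤j = detour-follows-walk k i (λ i′ i′<i → ¬S′⇒E (Sc (suc k + i′)) (in-gap i′ (≤-trans i′<i i≤j)))
        hit′ : S′ (detour (τ (c k)) j) ≡ true
        hit′ = trans (cong S′ (follows j ≤-refl)) hit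
        before : ∀ i → i < j → S′ (detour (τ (c k)) i) ≡ false
        before i i<j = trans (cong S′ (follows i (<⇒≤ i<j))) (in-gap i i<j)

    γτ-walk⇒γ′τ : ∀ k → S′ (c k) ≡ true → sameOrbit γ′ τ x (c k) ≡ true
    γτ-walk⇒γ′τ k = go k (<-wellFounded k)
      where
        go : ∀ k → Acc _<_ k → S′ (c k) ≡ true → sameOrbit γ′ τ x (c k) ≡ true
        go zero _ _ = γ′τ.sameOrbit-refl x Sx′
        go (suc m) (acc smaller) hit with last-witness (λ i → S′ (c i)) Sx′ m
        ... | k , k≤m , Sck′ , gap =
          subst (λ v → sameOrbit γ′ τ x v ≡ true) (γ′-skips-E k m k≤m Sck′ gap hit)
                (γ′τ.sameOrbit-α x _ Sx′ (γ′τ.sameOrbit-β x _ Sx′ (go k (smaller (s≤s k≤m)) Sck′)))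

    γτ⇒γ′τ : ∀ y → S′ y ≡ true → sameOrbit γ τ x y ≡ true → sameOrbit γ′ τ x y ≡ true
    γτ⇒γ′τ y Sy′ xy with γτ.sameOrbit⇒Reach x y xy
    ... | k , inj₁ refl = γτ-walk⇒γ′τ k Sy′
    ... | k , inj₂ refl = γ′τ.sameOrbit-β x (c k) Sx′
          (γτ-walk⇒γ′τ k (subst (λ v → S′ v ≡ true) (τ-invol _ (Sc k)) (τ-closed′ _ Sy′)))

  γτ⇒γr-inside-E : ∀ x → S x ≡ true → (∀ y → sameOrbit γ r x y ≡ true → E y ≡ true) →
                   ∀ y → sameOrbit γ τ x y ≡ true → sameOrbit γ r x y ≡ true
  γτ⇒γr-inside-E x Sx in-E = γτ.sameOrbit-ind x (λ y → sameOrbit γ r x y ≡ true) Sx (γr.sameOrbit-refl x Sx)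
    (λ y _ → γr.sameOrbit-α x y Sx)
    (λ y Sy xy → subst (λ v → sameOrbit γ r x v ≡ true) (sym (τ≡r-on-E y Sy (in-E y xy))) (γr.sameOrbit-β x y Sx xy))

  γr⇒γτ-inside-E : ∀ x → S x ≡ true → (∀ y → sameOrbit γ τ x y ≡ true → E y ≡ true) →
                   ∀ y → sameOrbit γ r x y ≡ true → sameOrbit γ τ x y ≡ true
  γr⇒γτ-inside-E x Sx in-E = γr.sameOrbit-ind x (λ y → sameOrbit γ τ x y ≡ true) Sx (γτ.sameOrbit-refl x Sx)
    (λ y _ → γτ.sameOrbit-α x y Sx)
    (λ y Sy xy → subst (λ v → sameOrbit γ τ x v ≡ true) (τ≡r-on-E y Sy (in-E y xy)) (γτ.sameOrbit-β x y Sx xy))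

  survivingRep : Fin n → Bool
  survivingRep x = S′ x ∧ isRep γ′ τ x

  vanishingRep : Fin n → Bool
  vanishingRep x = S x ∧ E x ∧ isRep γ r x ∧ all E (orbit γ r x)

  vanishingRep-orbit-in-E : ∀ x → vanishingRep x ≡ true → ∀ y → sameOrbit γ r x y ≡ true → E y ≡ true
  vanishingRep-orbit-in-E x h y xy with any-∈⁻ (eqᵇ y) (orbit γ r x) xy
  ... | z , z∈orbit , y≡z rewrite eqᵇ⇒≡ y≡z = all-∈⁻ E (∧-elimʳ {isRep γ r x} (∧-elimʳ {E x} (∧-elimʳ {S x} h))) z∈orbit

  vanishingRep-intro : ∀ x → S x ≡ true → (∀ y → sameOrbit γ τ x y ≡ true → E y ≡ true) →
                       isRep γ τ x ≡ true → vanishingRep x ≡ true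
  vanishingRep-intro x Sx in-E rep =
    ∧-intro Sx (∧-intro (in-E x (γτ.sameOrbit-refl x Sx)) (∧-intro rep′
      (all-∈⁺ E (orbit γ r x) (λ y y∈orbit → in-E y (γr⇒γτ-inside-E x Sx in-E y (any-∈⁺ (eqᵇ y) y∈orbit (eqᵇ-refl y)))))))
    where
      rep′ : isRep γ r x ≡ true
      rep′ = minimal⇒isRep γ r x (λ y xy → isRep⇒minimal γ τ x rep y (γr⇒γτ-inside-E x Sx in-E y xy))

  vanishingRep-isRep : ∀ x → vanishingRep x ≡ true → isRep γ r x ≡ true
  vanishingRep-isRep x h = ∧-elimˡ (∧-elimʳ {E x} (∧-elimʳ {S x} h))

  surviving-rep-exists : ∀ x y → S x ≡ true → sameOrbit γ τ x y ≡ true → S′ y ≡ true →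
                         ∃ λ m → sameOrbit γ τ x m ≡ true × survivingRep m ≡ true
  surviving-rep-exists x y Sx xy Sy′ =
    let m , ym , rep = proj₁ γ′τ.isRep-transversal y Sy′
    in m , γτ.sameOrbit-trans x y m Sx xy (γ′τ⇒γτ y Sy′ m ym) , ∧-intro (γ′τ.sameOrbit-closed y m Sy′ ym) rep

  vanishing-rep-exists : ∀ x → S x ≡ true → (∀ y → sameOrbit γ τ x y ≡ true → E y ≡ true) →
                         ∃ λ m → sameOrbit γ τ x m ≡ true × vanishingRep m ≡ true
  vanishing-rep-exists x Sx in-E with proj₁ γτ.isRep-transversal x Sx
  ... | m , xm , rep = m , xm , vanishingRep-intro m Sm (λ y my → in-E y (γτ.sameOrbit-trans x m y Sx xm my)) rep
    where Sm = γτ.sameOrbit-closed x m Sx xm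

  rep-exists : ∀ x → S x ≡ true → ∃ λ m → sameOrbit γ τ x m ≡ true × (survivingRep m ∨ vanishingRep m) ≡ true
  rep-exists x Sx with search-within (sameOrbit γ τ x) (λ y → not (S′ y))
  ... | inj₁ (y , xy , Sy′) =
    let m , xm , surv = surviving-rep-exists x y Sx xy (not-injective {S′ y} {true} Sy′) in m , xm , ∨-introˡ surv
  ... | inj₂ no-S′ =
    let m , xm , van = vanishing-rep-exists x Sx in-E in m , xm , ∨-introʳ van
    where
      in-E : ∀ y → sameOrbit γ τ x y ≡ true → E y ≡ true
      in-E y xy = ¬S′⇒E (γτ.sameOrbit-closed x y Sx xy) (not-injective {S′ y} {false} (no-S′ y xy))

  rep-unique : ∀ y y′ → S y ≡ true →
               (survivingRep y ∨ vanishingRep y) ≡ true → (survivingRep y′ ∨ vanishingRep y′) ≡ true →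
               sameOrbit γ τ y y′ ≡ true → y ≡ y′
  rep-unique y y′ Sy rep rep′ yy′ with ∨-elim {survivingRep y} rep | ∨-elim {survivingRep y′} rep′
  ... | inj₁ surv | inj₁ surv′ =
    proj₂ γ′τ.isRep-transversal y y′ (∧-elimˡ surv) (∧-elimʳ {S′ y} surv) (∧-elimʳ {S′ y′} surv′)
          (γτ⇒γ′τ y (∧-elimˡ surv) y′ (∧-elimˡ surv′) yy′)
  ... | inj₂ van | inj₂ van′ =
    proj₂ γr.isRep-transversal y y′ Sy (vanishingRep-isRep y van) (vanishingRep-isRep y′ van′)
          (γτ⇒γr-inside-E y Sy (vanishingRep-orbit-in-E y van) y′ yy′)
  ... | inj₁ surv | inj₂ van′ = ⊥-elim (true≢false
          (vanishingRep-orbit-in-E y′ van′ y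
            (γτ⇒γr-inside-E y′ Sy′ (vanishingRep-orbit-in-E y′ van′) y (γτ.sameOrbit-sym y y′ Sy yy′)))
          (S′⇒¬E (∧-elimˡ surv)))
    where Sy′ = γτ.sameOrbit-closed y y′ Sy yy′
  ... | inj₂ van | inj₁ surv′ = ⊥-elim (true≢false
          (vanishingRep-orbit-in-E y van y′ (γτ⇒γr-inside-E y Sy (vanishingRep-orbit-in-E y van) y′ yy′))
          (S′⇒¬E (∧-elimˡ surv′)))

  count-γτ-orbits : countFin n (λ x → S x ∧ isRep γ τ x) ≡ countFin n survivingRep + countFin n vanishingRep
  count-γτ-orbits =
    trans (Transversal.count-transversal (sameOrbit γ τ) γτ.sameOrbit-equivalence
                                         γτ.isRep-transversal (rep-exists , rep-unique))
          (trans (countFin-cong n reps-in-S) (countFin-∨ n disjoint))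
    where
      reps-in-S : ∀ x → S x ∧ (survivingRep x ∨ vanishingRep x) ≡ survivingRep x ∨ vanishingRep x
      reps-in-S x with S x
      ... | true = refl
      ... | false = refl
      disjoint : ∀ x → survivingRep x ∧ vanishingRep x ≡ false
      disjoint x with survivingRep x in surv
      ... | false = refl
      ... | true rewrite S′⇒¬E (∧-elimˡ surv) = ∧-falseʳ {S x} refl

module Hyperedges (H : Gehm) where
  open Counting
  open Orbits
  open import Data.Bool.Base using (false; if_then_else_; _∨_)
  open import Data.List.Base using ([]; _∷_; allFin)
  open import Data.Bool.ListAction using (any)
  open import Data.List.Membership.Propositional.Properties using (∈-allFin)
  open import Data.Product using (∃; _×_; _,_; proj₁; proj₂)
  open import Relation.Binary.PropositionalEquality

  open Gehm H

  module br = DihedralOrbits b r (λ _ → true) (λ _ _ → refl) (λ _ _ → refl) (λ x _ → b-invol x) (λ x _ → r-invol x)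

  sameOrbit-b : ∀ x → sameOrbit b r x (b x) ≡ true
  sameOrbit-b x = br.sameOrbit-α x x refl (br.sameOrbit-refl x refl)

  sameOrbit-r : ∀ x → sameOrbit b r x (r x) ≡ true
  sameOrbit-r x = br.sameOrbit-β x x refl (br.sameOrbit-refl x refl)

  sameOrbit-resp : ∀ e x y → sameOrbit b r x y ≡ true → sameOrbit b r e x ≡ sameOrbit b r e y
  sameOrbit-resp e x y xy =
    ⇔⇒≡ (λ ex → br.sameOrbit-trans e x y refl ex xy)
        (λ ey → br.sameOrbit-trans e y x refl ey (br.sameOrbit-sym x y refl xy))

  sameOrbit-respˡ : ∀ x y → sameOrbit b r x y ≡ true → ∀ z → sameOrbit b r x z ≡ sameOrbit b r y z
  sameOrbit-respˡ x y xy z =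
    ⇔⇒≡ (λ xz → br.sameOrbit-trans y x z refl (br.sameOrbit-sym x y refl xy) xz)
        (λ yz → br.sameOrbit-trans x y z refl xy yz)

  hyperedge-unique : ∀ e e′ x → isRep b r e ≡ true → isRep b r e′ ≡ true →
                     sameOrbit b r e x ≡ true → sameOrbit b r e′ x ≡ true → e ≡ e′
  hyperedge-unique e e′ x rep rep′ ex e′x =
    proj₂ br.isRep-transversal e e′ refl rep rep′ (br.sameOrbit-trans e x e′ refl ex (br.sameOrbit-sym e′ x refl e′x))

  ∈-hyperedges⁻ : ∀ {e} → e ∈ hyperedges H → isRep b r e ≡ true
  ∈-hyperedges⁻ e∈ = proj₁ (∈-keep⁻ (isRep b r) (allFin n) e∈)

  hyperedge-exists : ∀ x → ∃ λ e → e ∈ hyperedges H × sameOrbit b r e x ≡ true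
  hyperedge-exists x with proj₁ br.isRep-transversal x refl
  ... | e , xe , rep = e , ∈-keep⁺ (isRep b r) (allFin n) rep (∈-allFin e) , br.sameOrbit-sym x e refl xe

  onHyperedgeOf : List (Fin n) → Fin n → Bool
  onHyperedgeOf A x = any (λ a → sameOrbit b r a x) A

  -- The graph state τ_A of H_m: the c-state (pairing the ends of the b-edges) at the hyperedges of A,
  -- the d-state (pairing the ends of the r-edges) at all others.
  state : List (Fin n) → Fin n → Fin n
  state A x = if onHyperedgeOf A x then b x else r x

  onHyperedgeOf≡∈ : ∀ A → (∀ a → a ∈ A → isRep b r a ≡ true) → ∀ e x → isRep b r e ≡ true →
                    sameOrbit b r e x ≡ true → onHyperedgeOf A x ≡ any (eqᵇ e) A
  onHyperedgeOf≡∈ A A-reps e x rep ex = ⇔⇒≡ to from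
    where
      to : onHyperedgeOf A x ≡ true → any (eqᵇ e) A ≡ true
      to h with any-∈⁻ (λ a → sameOrbit b r a x) A h
      ... | a , a∈A , ax =
        any-∈⁺ (eqᵇ e) a∈A (subst (λ w → eqᵇ e w ≡ true) (hyperedge-unique e a x rep (A-reps a a∈A) ex ax) (eqᵇ-refl e))
      from : any (eqᵇ e) A ≡ true → onHyperedgeOf A x ≡ true
      from h with any-∈⁻ (eqᵇ e) A h
      ... | a , a∈A , e≡a = any-∈⁺ (λ a → sameOrbit b r a x) a∈A (subst (λ w → sameOrbit b r w x ≡ true) (eqᵇ⇒≡ e≡a) ex)

  onHyperedgeOf-resp : ∀ A x y → sameOrbit b r x y ≡ true → onHyperedgeOf A x ≡ onHyperedgeOf A y
  onHyperedgeOf-resp [] x y xy = refl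
  onHyperedgeOf-resp (a ∷ A) x y xy = cong₂ _∨_ (sameOrbit-resp a x y xy) (onHyperedgeOf-resp A x y xy)

  state-b : ∀ A x → onHyperedgeOf A x ≡ true → state A x ≡ b x
  state-b A x h rewrite h = refl

  state-r : ∀ A x → onHyperedgeOf A x ≡ false → state A x ≡ r x
  state-r A x h rewrite h = refl

  sameOrbit-state : ∀ A x → sameOrbit b r x (state A x) ≡ true
  sameOrbit-state A x with onHyperedgeOf A x
  ... | true = sameOrbit-b x
  ... | false = sameOrbit-r x

  state-invol : ∀ A x → state A (state A x) ≡ x
  state-invol A x with onHyperedgeOf A x in h
  ... | true = trans (state-b A (b x) (trans (sym (onHyperedgeOf-resp A x (b x) (sameOrbit-b x))) h)) (b-invol x)
  ... | false = trans (state-r A (r x) (trans (sym (onHyperedgeOf-resp A x (r x) (sameOrbit-r x))) h)) (r-invol x)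

-- Deleting the hyperedges outside A one at a time (`CycleDeletion` with τ = state A, which is r on them)
-- preserves the number of ⟨g, state A⟩-orbits plus isolates. On the surviving vertices state A = b, so at
-- the end these orbits are the b–g cycles, the hyperfaces of H_{|A}.
module Restriction (H : Gehm) (A : List (Fin (Gehm.n H)))
  (A-reps : ∀ a → a ∈ A → isRep (Gehm.b H) (Gehm.r H) a ≡ true) where
  open Counting
  open Orbits
  open import Data.Nat.Base using (_+_)
  open import Data.Nat.Properties using (+-assoc; +-comm)
  open import Data.Bool.Base using (false; _∧_; not)
  open import Data.Bool.Properties using (not-injective)
  open import Data.List.Base using ([]; _∷_; foldr; allFin)
  open import Data.Bool.ListAction using (any)
  open import Data.List.Relation.Unary.Any using (here; there)
  open import Data.Product using (∃; _×_; _,_)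
  open import Data.Empty using (⊥-elim)
  open import Relation.Binary.PropositionalEquality
  open import Function.Base using (_∘_)

  open Gehm H
  open Hyperedges H

  τ : Fin n → Fin n
  τ = state A

  -- `deleteHE` never changes b and r, so every intermediate gehm is of this form.
  fromAlive : (Fin n → Bool) → (Fin n → Fin n) → ℕ → PGehm n
  fromAlive alive g′ iso = record { alive = alive ; b = b ; g = g′ ; r = r ; iso = iso }

  record Invariant (deleted : List (Fin n)) (alive : Fin n → Bool) (g′ : Fin n → Fin n) (iso : ℕ) : Set where
    field
      b-closed     : ∀ x → alive x ≡ true → alive (b x) ≡ true
      r-closed     : ∀ x → alive x ≡ true → alive (r x) ≡ true
      deleted-dead : ∀ x → alive x ≡ true → ∀ e → e ∈ deleted → sameOrbit b r e x ≡ false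
      g′-closed    : ∀ x → alive x ≡ true → alive (g′ x) ≡ true
      g′-invol     : ∀ x → alive x ≡ true → g′ (g′ x) ≡ x
      orbits-kept  : countFin n (isRep g τ) + isolates ≡ countFin n (λ x → alive x ∧ isRep g′ τ x) + iso

  Reachable : List (Fin n) → PGehm n → Set
  Reachable deleted P = ∃ λ alive → ∃ λ g′ → ∃ λ iso → P ≡ fromAlive alive g′ iso × Invariant deleted alive g′ iso

  reachable-start : Reachable [] (toP H)
  reachable-start = (λ _ → true) , g , isolates , refl , record
    { b-closed = λ _ _ → refl ; r-closed = λ _ _ → refl ; deleted-dead = λ _ _ _ () ; g′-closed = λ _ _ → refl
    ; g′-invol = λ x _ → g-invol x ; orbits-kept = refl }

  reachable-step : ∀ P deleted e → isRep b r e ≡ true → any (eqᵇ e) A ≡ false →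
                   Reachable deleted P → Reachable (e ∷ deleted) (deleteHE P e)
  reachable-step P deleted e rep e∉A (alive , g′ , iso , refl , I) = _ , _ , _ , refl , record
    { b-closed = λ x h → S′-intro (b-closed x (S′⇒S h)) (trans (sym (sameOrbit-resp e x (b x) (sameOrbit-b x))) (S′⇒¬E h))
    ; r-closed = λ x h → S′-intro (r-closed x (S′⇒S h)) (trans (sym (sameOrbit-resp e x (r x) (sameOrbit-r x))) (S′⇒¬E h))
    ; deleted-dead = λ { x h e′ (here refl) → S′⇒¬E h ; x h e′ (there e′∈) → deleted-dead x (S′⇒S h) e′ e′∈ }
    ; g′-closed = γ′-closed
    ; g′-invol = γ′-invol
    ; orbits-kept = begin
        countFin n (isRep g τ) + isolates
          ≡⟨ orbits-kept ⟩
        countFin n (λ x → alive x ∧ isRep g′ τ x) + iso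
          ≡⟨ cong (_+ iso) count-γτ-orbits ⟩
        (#surviving + #vanishing) + iso
          ≡⟨ +-assoc #surviving #vanishing iso ⟩
        #surviving + (#vanishing + iso)
          ≡⟨ cong (#surviving +_) (+-comm #vanishing iso) ⟩
        #surviving + (iso + #vanishing)
          ≡⟨ cong (λ k → #surviving + (iso + k)) (count-allFin n vanishingRep) ⟨
        #surviving + (iso + count vanishingRep (allFin n)) ∎
    }
    where
      open Invariant I
      open ≡-Reasoning
      τ-on-e : ∀ x → sameOrbit b r e x ≡ true → τ x ≡ r x
      τ-on-e x ex = state-r A x (trans (onHyperedgeOf≡∈ A A-reps e x rep ex) e∉A)
      τ-closed : ∀ x → alive x ≡ true → alive (τ x) ≡ true
      τ-closed x h with onHyperedgeOf A x
      ... | true = b-closed x h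
      ... | false = r-closed x h
      open CycleDeletion alive (sameOrbit b r e) g′ τ r g′-closed g′-invol τ-closed (λ x _ → state-invol A x)
             r-closed (λ x _ → r-invol x) (λ x _ → sym (sameOrbit-resp e x (r x) (sameOrbit-r x)))
             (λ x _ → sym (sameOrbit-resp e x (τ x) (sameOrbit-state A x))) (λ x _ → τ-on-e x)
      #surviving #vanishing : ℕ
      #surviving = countFin n survivingRep
      #vanishing = countFin n vanishingRep

  deleted : List (Fin n)
  deleted = keep (λ e → not (any (eqᵇ e) A)) (hyperedges H)

  restrict-reachable : Reachable deleted (restrict H A)
  restrict-reachable = go deleted (λ e e∈ → e∈)
    where
      go : ∀ L → (∀ e → e ∈ L → e ∈ deleted) → Reachable L (foldr (λ e P → deleteHE P e) (toP H) L)
      go [] _ = reachable-start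
      go (e ∷ L) L⊆ with ∈-keep⁻ _ (hyperedges H) (L⊆ e (here refl))
      ... | e∉A , e∈ = reachable-step _ L e (∈-hyperedges⁻ e∈) (not-injective e∉A) (go L (λ e′ → L⊆ e′ ∘ there))

  module Final {alive : Fin n → Bool} {g′ : Fin n → Fin n} {iso : ℕ} (I : Invariant deleted alive g′ iso) where
    open Invariant I

    τ≡b : ∀ x → alive x ≡ true → τ x ≡ b x
    τ≡b x h with hyperedge-exists x
    ... | e , e∈ , ex with any (eqᵇ e) A in e∈A
    ... | true = state-b A x (trans (onHyperedgeOf≡∈ A A-reps e x (∈-hyperedges⁻ e∈) ex) e∈A)
    ... | false = ⊥-elim (true≢false ex (deleted-dead x h e (∈-keep⁺ _ (hyperedges H) (cong not e∈A) e∈)))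

    module bg′ = DihedralOrbits b g′ alive b-closed g′-closed (λ x _ → b-invol x) g′-invol
    module g′τ = DihedralOrbits g′ τ alive g′-closed (λ x h → subst (λ v → alive v ≡ true) (sym (τ≡b x h)) (b-closed x h))
                   g′-invol (λ x _ → state-invol A x)

    hyperfaces≡orbits : ∀ x → alive x ∧ isRep b g′ x ≡ alive x ∧ isRep g′ τ x
    hyperfaces≡orbits x with alive x in h
    ... | false = refl
    ... | true = isRep-cong {α = b} {g′} {g′} {τ} x
        (bg′.sameOrbit-ind x (λ y → sameOrbit g′ τ x y ≡ true) h (g′τ.sameOrbit-refl x h)
           (λ y hy xy → subst (λ v → sameOrbit g′ τ x v ≡ true) (τ≡b y hy) (g′τ.sameOrbit-β x y h xy))
           (λ y _ → g′τ.sameOrbit-α x y h))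
        (g′τ.sameOrbit-ind x (λ y → sameOrbit b g′ x y ≡ true) h (bg′.sameOrbit-refl x h)
           (λ y _ → bg′.sameOrbit-β x y h)
           (λ y hy xy → subst (λ v → sameOrbit b g′ x v ≡ true) (sym (τ≡b y hy)) (bg′.sameOrbit-α x y h xy)))

  f≡orbits : f H A ≡ countOrbits g τ (λ _ → true) + isolates
  f≡orbits with restrict-reachable
  ... | alive , g′ , iso , eq , I = trans (cong hyperfaces eq)
        (trans (cong (_+ iso) (trans (count-allFin n _) (countFin-cong n (Final.hyperfaces≡orbits I))))
               (sym (trans (cong (_+ isolates) (count-allFin n _)) (Invariant.orbits-kept I))))

module RingSums {c ℓ : Level} (R : CommutativeRing c ℓ) where
  open Counting
  open import Data.Nat.Base using (zero; suc) renaming (_+_ to _+ℕ_)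
  open import Data.Bool.Base using (false; if_then_else_; _∧_)
  open import Data.Fin.Base using (zero; suc)
  open import Data.List.Base using ([]; _∷_; map; _++_; concatMap; tabulate; allFin)
  open import Data.Vec.Base using (Vec; lookup) renaming (_∷_ to _∷ᵥ_)
  open import Data.List.Membership.Propositional.Properties using (∈-allFin)
  open import Data.Bool.ListAction using (all)
  open import Data.List.Relation.Unary.Any using (here; there)
  open import Data.List.Relation.Unary.Unique.Propositional using (Unique)
  open import Data.List.Relation.Unary.Unique.Propositional.Properties using (Unique[x∷xs]⇒x∉xs; allFin⁺)
  open import Data.List.Relation.Unary.AllPairs using (_∷_)
  open import Function.Base using (_∘_)
  import Relation.Binary.PropositionalEquality as ≡
  open ≡ using (_≡_; _≢_)

  open CommutativeRing R hiding (zero) renaming (Carrier to K)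
  open import Relation.Binary.Reasoning.Setoid setoid
  open import Algebra.Properties.CommutativeMonoid.Sum *-commutativeMonoid public
    using () renaming (sum to ∏; sum-cong-≋ to ∏-cong; ∑-distrib-+ to ∏-distrib-*; sum-replicate-zero to ∏-replicate-1)

  ∑ₗ : ∀ {A : Set} → (A → K) → List A → K
  ∑ₗ F xs = sumK R (map F xs)

  ∏ₗ : ∀ {A : Set} → (A → K) → List A → K
  ∏ₗ F xs = prodK R (map F xs)

  𝟙 : Bool → K
  𝟙 true = 1#
  𝟙 false = 0#

  ≡⇒≈ : ∀ {x y : K} → x ≡ y → x ≈ y
  ≡⇒≈ ≡.refl = refl

  ∑ₗ-cong : ∀ {A : Set} {F G : A → K} (xs : List A) → (∀ x → x ∈ xs → F x ≈ G x) → ∑ₗ F xs ≈ ∑ₗ G xs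
  ∑ₗ-cong [] _ = refl
  ∑ₗ-cong (x ∷ xs) F≈G = +-cong (F≈G x (here ≡.refl)) (∑ₗ-cong xs (λ y → F≈G y ∘ there))

  ∏ₗ-cong : ∀ {A : Set} {F G : A → K} (xs : List A) → (∀ x → x ∈ xs → F x ≈ G x) → ∏ₗ F xs ≈ ∏ₗ G xs
  ∏ₗ-cong [] _ = refl
  ∏ₗ-cong (x ∷ xs) F≈G = *-cong (F≈G x (here ≡.refl)) (∏ₗ-cong xs (λ y → F≈G y ∘ there))

  ∑ₗ-++ : ∀ {A : Set} (F : A → K) (xs ys : List A) → ∑ₗ F (xs ++ ys) ≈ ∑ₗ F xs + ∑ₗ F ys
  ∑ₗ-++ F [] ys = sym (+-identityˡ _)
  ∑ₗ-++ F (x ∷ xs) ys = trans (+-congˡ (∑ₗ-++ F xs ys)) (sym (+-assoc _ _ _))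

  ∑ₗ-map : ∀ {A B : Set} (F : B → K) (g : A → B) (xs : List A) → ∑ₗ F (map g xs) ≡ ∑ₗ (F ∘ g) xs
  ∑ₗ-map F g [] = ≡.refl
  ∑ₗ-map F g (x ∷ xs) = ≡.cong (F (g x) +_) (∑ₗ-map F g xs)

  ∑ₗ-keep : ∀ {A : Set} (F : A → K) (p : A → Bool) (xs : List A) → ∑ₗ F (keep p xs) ≈ ∑ₗ (λ x → 𝟙 (p x) * F x) xs
  ∑ₗ-keep F p [] = refl
  ∑ₗ-keep F p (x ∷ xs) with p x
  ... | true = +-cong (sym (*-identityˡ _)) (∑ₗ-keep F p xs)
  ... | false = trans (sym (+-identityˡ _)) (+-cong (sym (zeroˡ _)) (∑ₗ-keep F p xs))

  ∑ₗ-concatMap : ∀ {A B : Set} (F : B → K) (G : A → List B) (xs : List A) →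
                 ∑ₗ F (concatMap G xs) ≈ ∑ₗ (λ x → ∑ₗ F (G x)) xs
  ∑ₗ-concatMap F G [] = refl
  ∑ₗ-concatMap F G (x ∷ xs) = trans (∑ₗ-++ F (G x) (concatMap G xs)) (+-congˡ (∑ₗ-concatMap F G xs))

  ∑ₗ-distribˡ : ∀ {A : Set} (a : K) (F : A → K) (xs : List A) → ∑ₗ (λ x → a * F x) xs ≈ a * ∑ₗ F xs
  ∑ₗ-distribˡ a F [] = sym (zeroʳ a)
  ∑ₗ-distribˡ a F (x ∷ xs) = trans (+-congˡ (∑ₗ-distribˡ a F xs)) (sym (distribˡ a _ _))

  ∑ₗ-distribʳ : ∀ {A : Set} (a : K) (F : A → K) (xs : List A) → ∑ₗ (λ x → F x * a) xs ≈ ∑ₗ F xs * a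
  ∑ₗ-distribʳ a F [] = sym (zeroˡ a)
  ∑ₗ-distribʳ a F (x ∷ xs) = trans (+-congˡ (∑ₗ-distribʳ a F xs)) (sym (distribʳ a _ _))

  ∑ₗ-zero : ∀ {A : Set} {F : A → K} (xs : List A) → (∀ x → x ∈ xs → F x ≈ 0#) → ∑ₗ F xs ≈ 0#
  ∑ₗ-zero [] _ = refl
  ∑ₗ-zero (x ∷ xs) F≈0 = trans (+-cong (F≈0 x (here ≡.refl)) (∑ₗ-zero xs (λ y → F≈0 y ∘ there))) (+-identityˡ 0#)

  ∑ₗ-distrib-+ : ∀ {A : Set} (F G : A → K) (xs : List A) → ∑ₗ (λ x → F x + G x) xs ≈ ∑ₗ F xs + ∑ₗ G xs
  ∑ₗ-distrib-+ F G [] = sym (+-identityˡ _)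
  ∑ₗ-distrib-+ F G (x ∷ xs) = begin
    (F x + G x) + ∑ₗ (λ x → F x + G x) xs ≈⟨ +-congˡ (∑ₗ-distrib-+ F G xs) ⟩
    (F x + G x) + (∑ₗ F xs + ∑ₗ G xs)     ≈⟨ +-assoc _ _ _ ⟩
    F x + (G x + (∑ₗ F xs + ∑ₗ G xs))     ≈⟨ +-congˡ (+-assoc _ _ _) ⟨
    F x + ((G x + ∑ₗ F xs) + ∑ₗ G xs)     ≈⟨ +-congˡ (+-congʳ (+-comm _ _)) ⟩
    F x + ((∑ₗ F xs + G x) + ∑ₗ G xs)     ≈⟨ +-congˡ (+-assoc _ _ _) ⟩
    F x + (∑ₗ F xs + (G x + ∑ₗ G xs))     ≈⟨ +-assoc _ _ _ ⟨
    (F x + ∑ₗ F xs) + (G x + ∑ₗ G xs)     ∎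

  ∑ₗ-comm : ∀ {A B : Set} (F : A → B → K) (xs : List A) (ys : List B) →
            ∑ₗ (λ x → ∑ₗ (F x) ys) xs ≈ ∑ₗ (λ y → ∑ₗ (λ x → F x y) xs) ys
  ∑ₗ-comm F [] ys = sym (∑ₗ-zero ys (λ _ _ → refl))
  ∑ₗ-comm F (x ∷ xs) ys = trans (+-congˡ (∑ₗ-comm F xs ys)) (sym (∑ₗ-distrib-+ (F x) _ ys))

  ∑ₗ-indicator : ∀ {n} (xs : List (Fin n)) → Unique xs → ∀ {c} → c ∈ xs → ∑ₗ (λ x → 𝟙 (eqᵇ x c)) xs ≈ 1#
  ∑ₗ-indicator (x ∷ xs) uniq (here ≡.refl) =
    trans (+-cong (≡⇒≈ (≡.cong 𝟙 (eqᵇ-refl x))) (∑ₗ-zero xs (λ y y∈xs → ≡⇒≈ (≡.cong 𝟙 (≢⇒eqᵇ≡false (y≢x y y∈xs))))))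
          (+-identityʳ 1#)
    where
      y≢x : ∀ y → y ∈ xs → y ≢ x
      y≢x y y∈xs ≡.refl = Unique[x∷xs]⇒x∉xs uniq y∈xs
  ∑ₗ-indicator (x ∷ xs) uniq@(_ ∷ uniq′) {c} (there c∈xs) =
    trans (+-cong (≡⇒≈ (≡.cong 𝟙 (≢⇒eqᵇ≡false x≢c))) (∑ₗ-indicator xs uniq′ c∈xs)) (+-identityˡ 1#)
    where
      x≢c : x ≢ c
      x≢c ≡.refl = Unique[x∷xs]⇒x∉xs uniq c∈xs

  ∑-agreeing-vectors : ∀ {N} m (τ : Fin m → Fin N) →
                       ∑ₗ (λ w → ∏ (λ i → 𝟙 (eqᵇ (lookup w i) (τ i)))) (allVecs m) ≈ 1#
  ∑-agreeing-vectors zero τ = +-identityʳ 1#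
  ∑-agreeing-vectors {N} (suc m) τ = begin
    ∑ₗ agreeing (concatMap (λ x → map (x ∷ᵥ_) (allVecs m)) (allFin N))
      ≈⟨ ∑ₗ-concatMap agreeing (λ x → map (x ∷ᵥ_) (allVecs m)) (allFin N) ⟩
    ∑ₗ (λ x → ∑ₗ agreeing (map (x ∷ᵥ_) (allVecs m))) (allFin N)
      ≈⟨ ∑ₗ-cong (allFin N) (λ x _ → ≡⇒≈ (∑ₗ-map agreeing (x ∷ᵥ_) (allVecs m))) ⟩
    ∑ₗ (λ x → ∑ₗ (λ w → 𝟙 (eqᵇ x (τ zero)) * agreeing′ w) (allVecs m)) (allFin N)
      ≈⟨ ∑ₗ-cong (allFin N) (λ x _ → trans (∑ₗ-distribˡ _ agreeing′ (allVecs m))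
                                          (trans (*-congˡ (∑-agreeing-vectors m (τ ∘ suc))) (*-identityʳ _))) ⟩
    ∑ₗ (λ x → 𝟙 (eqᵇ x (τ zero))) (allFin N)
      ≈⟨ ∑ₗ-indicator (allFin N) (allFin⁺ N) (∈-allFin (τ zero)) ⟩
    1# ∎
    where
      agreeing : Vec (Fin N) (suc m) → K
      agreeing w = ∏ (λ i → 𝟙 (eqᵇ (lookup w i) (τ i)))
      agreeing′ : Vec (Fin N) m → K
      agreeing′ w = ∏ (λ i → 𝟙 (eqᵇ (lookup w i) (τ (suc i))))

  𝟙-∧ : ∀ a b → 𝟙 (a ∧ b) ≈ 𝟙 a * 𝟙 b
  𝟙-∧ true b = sym (*-identityˡ _)
  𝟙-∧ false b = sym (zeroˡ _)

  𝟙-all-tabulate : ∀ {A : Set} n (p : A → Bool) (f : Fin n → A) → 𝟙 (all p (tabulate f)) ≈ ∏ (𝟙 ∘ p ∘ f)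
  𝟙-all-tabulate zero p f = refl
  𝟙-all-tabulate (suc n) p f = trans (𝟙-∧ (p (f zero)) _) (*-congˡ (𝟙-all-tabulate n p (f ∘ suc)))

  ∏ₗ-keep-tabulate : ∀ {A : Set} n (F : A → K) (p : A → Bool) (f : Fin n → A) →
                     ∏ₗ F (keep p (tabulate f)) ≈ ∏ (λ i → if p (f i) then F (f i) else 1#)
  ∏ₗ-keep-tabulate zero F p f = refl
  ∏ₗ-keep-tabulate (suc n) F p f with p (f zero)
  ... | true = *-congˡ (∏ₗ-keep-tabulate n F p (f ∘ suc))
  ... | false = trans (∏ₗ-keep-tabulate n F p (f ∘ suc)) (sym (*-identityˡ _))

  ∏-one : ∀ {n} (F : Fin n → K) → (∀ i → F i ≈ 1#) → ∏ F ≈ 1#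
  ∏-one {n} F F≈1 = trans (∏-cong F≈1) (∏-replicate-1 n)

  ∏-zero : ∀ {n} (F : Fin n → K) (m : Fin n) → F m ≈ 0# → ∏ F ≈ 0#
  ∏-zero F zero F≈0 = trans (*-congʳ F≈0) (zeroˡ _)
  ∏-zero F (suc m) F≈0 = trans (*-congˡ (∏-zero (F ∘ suc) m F≈0)) (zeroʳ _)

  ∏-pow : ∀ n (p : Fin n → Bool) (a : K) → ∏ (λ i → if p i then a else 1#) ≈ pow R a (countFin n p)
  ∏-pow zero p a = refl
  ∏-pow (suc n) p a with p zero
  ... | true = *-congˡ (∏-pow n (p ∘ suc) a)
  ... | false = trans (*-identityˡ _) (∏-pow n (p ∘ suc) a)

  pow-+ : ∀ a m k → pow R a (m +ℕ k) ≈ pow R a m * pow R a k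
  pow-+ a zero k = sym (*-identityˡ _)
  pow-+ a (suc m) k = trans (*-congˡ (pow-+ a m k)) (sym (*-assoc _ _ _))

  *-interchange : ∀ a b c d → (a * b) * (c * d) ≈ (a * c) * (b * d)
  *-interchange a b c d = begin
    (a * b) * (c * d) ≈⟨ *-assoc _ _ _ ⟩
    a * (b * (c * d)) ≈⟨ *-congˡ (*-assoc _ _ _) ⟨
    a * ((b * c) * d) ≈⟨ *-congˡ (*-congʳ (*-comm _ _)) ⟩
    a * ((c * b) * d) ≈⟨ *-congˡ (*-assoc _ _ _) ⟩
    a * (c * (b * d)) ≈⟨ *-assoc _ _ _ ⟨
    (a * c) * (b * d) ∎

module Degrees (H : Gehm) where
  open Counting
  open import Data.Nat.Base using (zero; suc; _+_; z≤n; s≤s; _<ᵇ_; ⌊_/2⌋)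
  open import Data.Nat.Properties using (≤-refl; ≤-trans; ⌊n/2⌋-mono; <-asym; <-cmp)
  open import Data.Bool.Base using (false; _∧_; _∨_; not)
  open import Data.Bool.Properties using (∨-zeroʳ)
  open import Data.Fin.Base using (toℕ)
  open import Data.Fin.Properties using (_≟_; toℕ-injective)
  open import Data.Product using (_×_; _,_)
  open import Data.Sum using (_⊎_; inj₁; inj₂)
  open import Data.Empty using (⊥-elim)
  open import Relation.Nullary using (yes; no; ¬_)
  open import Relation.Binary.PropositionalEquality
  open import Function.Base using (_∘_)
  open import Relation.Binary.Definitions using (tri<; tri≈; tri>)

  open Gehm H
  open Hyperedges H

  size : Fin n → ℕ
  size e = countFin n (sameOrbit b r e)

  deg≡⌊size/2⌋ : ∀ e → deg H e ≡ ⌊ size e /2⌋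
  deg≡⌊size/2⌋ e = cong ⌊_/2⌋ (count-allFin n (sameOrbit b r e))

  size-resp : ∀ e x → sameOrbit b r e x ≡ true → size x ≡ size e
  size-resp e x ex = countFin-cong n (λ z → sym (sameOrbit-respˡ e x ex z))

  deg-resp : ∀ e x → sameOrbit b r e x ≡ true → deg H x ≡ deg H e
  deg-resp e x ex = trans (deg≡⌊size/2⌋ x) (trans (cong ⌊_/2⌋ (size-resp e x ex)) (sym (deg≡⌊size/2⌋ e)))

  walk-fixed : ∀ x → b x ≡ r x → ∀ k → br.walk k x ≡ x
  walk-fixed x b≡r zero = refl
  walk-fixed x b≡r (suc k) = trans (cong (λ z → b (r z)) (walk-fixed x b≡r k)) (trans (cong b (sym b≡r)) (b-invol x))

  class-when-b≡r : ∀ x → b x ≡ r x → ∀ y → sameOrbit b r x y ≡ true → y ≡ x ⊎ y ≡ b x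
  class-when-b≡r x b≡r y xy with br.sameOrbit⇒Reach x y xy
  ... | k , inj₁ refl = inj₁ (walk-fixed x b≡r k)
  ... | k , inj₂ refl = inj₂ (trans (cong r (walk-fixed x b≡r k)) (sym b≡r))

  ≢⇒not-eqᵇ : ∀ {y z : Fin n} → y ≢ z → not (eqᵇ y z) ≡ true
  ≢⇒not-eqᵇ y≢z = cong not (≢⇒eqᵇ≡false y≢z)

  size-when-b≡r : ∀ x → b x ≡ r x → size x ≡ 2
  size-when-b≡r x b≡r =
    trans (countFin-remove n (sameOrbit b r x) x (br.sameOrbit-refl x refl))
      (cong suc (trans (countFin-remove n _ (b x) (∧-intro (sameOrbit-b x) (≢⇒not-eqᵇ (b-fpf x))))
        (cong suc (countFin-none n only-two))))
    where
      only-two : ∀ y → (sameOrbit b r x y ∧ not (eqᵇ y x)) ∧ not (eqᵇ y (b x)) ≡ false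
      only-two y with sameOrbit b r x y in xy
      ... | false = refl
      ... | true with class-when-b≡r x b≡r y xy
      ... | inj₁ refl rewrite eqᵇ-refl y = refl
      ... | inj₂ refl rewrite eqᵇ-refl y = ∧-falseʳ {not (eqᵇ y x)} refl

  size-when-b≢r : ∀ x → b x ≢ r x → 4 ≤ size x
  size-when-b≢r x b≢r = subst (4 ≤_) (sym four-removed) (s≤s (s≤s (s≤s (s≤s z≤n))))
    where
      rb = r (b x)
      p₁ = λ y → sameOrbit b r x y ∧ not (eqᵇ y x)
      p₂ = λ y → p₁ y ∧ not (eqᵇ y (b x))
      p₃ = λ y → p₂ y ∧ not (eqᵇ y (r x))
      rb≢x : rb ≢ x
      rb≢x eq = b≢r (trans (sym (r-invol (b x))) (cong r eq))
      rb≢rx : rb ≢ r x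
      rb≢rx eq = b-fpf x (trans (sym (r-invol (b x))) (trans (cong r eq) (r-invol x)))
      four-removed : size x ≡ suc (suc (suc (suc (countFin n (λ y → p₃ y ∧ not (eqᵇ y rb))))))
      four-removed =
        trans (countFin-remove n (sameOrbit b r x) x (br.sameOrbit-refl x refl))
        (cong suc (trans (countFin-remove n p₁ (b x) (∧-intro (sameOrbit-b x) (≢⇒not-eqᵇ (b-fpf x))))
        (cong suc (trans (countFin-remove n p₂ (r x)
                           (∧-intro (∧-intro (sameOrbit-r x) (≢⇒not-eqᵇ (r-fpf x))) (≢⇒not-eqᵇ (b≢r ∘ sym))))
        (cong suc (countFin-remove n p₃ rb
          (∧-intro (∧-intro (∧-intro (br.sameOrbit-β x (b x) refl (sameOrbit-b x)) (≢⇒not-eqᵇ rb≢x))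
                            (≢⇒not-eqᵇ (r-fpf (b x))))
                   (≢⇒not-eqᵇ rb≢rx))))))))

  deg-dichotomy : ∀ e → (deg H e ≡ 1 × (∀ x → sameOrbit b r e x ≡ true → b x ≡ r x))
                      ⊎ (2 ≤ deg H e × (∀ x → sameOrbit b r e x ≡ true → b x ≢ r x))
  deg-dichotomy e with b e ≟ r e
  ... | yes b≡r = inj₁ (trans (deg≡⌊size/2⌋ e) (cong ⌊_/2⌋ (size-when-b≡r e b≡r)) , b≡r-on-class)
    where
      b≡r-on-class : ∀ x → sameOrbit b r e x ≡ true → b x ≡ r x
      b≡r-on-class x ex with class-when-b≡r e b≡r x ex
      ... | inj₁ refl = b≡r
      ... | inj₂ refl = trans (b-invol e) (sym (trans (cong r b≡r) (r-invol e)))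
  ... | no b≢r = inj₂ (subst (2 ≤_) (sym (deg≡⌊size/2⌋ e)) (⌊n/2⌋-mono (size-when-b≢r e b≢r)) , b≢r-on-class)
    where
      b≢r-on-class : ∀ x → sameOrbit b r e x ≡ true → b x ≢ r x
      b≢r-on-class x ex b≡r = 4≰2 (subst (4 ≤_) size≡2 (size-when-b≢r e b≢r))
        where
          4≰2 : ¬ 4 ≤ 2
          4≰2 (s≤s (s≤s ()))
          size≡2 : size e ≡ 2
          size≡2 = trans (sym (size-resp e x ex)) (size-when-b≡r x b≡r)

  deg≥1 : ∀ e → 1 ≤ deg H e
  deg≥1 e with deg-dichotomy e
  ... | inj₁ (d≡1 , _) = subst (1 ≤_) (sym d≡1) ≤-refl
  ... | inj₂ (2≤d , _) = ≤-trans (s≤s z≤n) 2≤d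

  lowerEnd : Fin n → Fin n → Bool
  lowerEnd e x = sameOrbit b r e x ∧ (toℕ x <ᵇ toℕ (b x))

  deg≡#b-edges : ∀ e → deg H e ≡ countFin n (lowerEnd e)
  deg≡#b-edges e = trans (deg≡⌊size/2⌋ e)
    (trans (cong ⌊_/2⌋ (trans split (cong (countFin n (lowerEnd e) +_) (sym swap)))) (⌊n+n/2⌋≡n _))
    where
      upperEnd : Fin n → Bool
      upperEnd x = sameOrbit b r e x ∧ (toℕ (b x) <ᵇ toℕ x)
      swap : countFin n (lowerEnd e) ≡ countFin n upperEnd
      swap = trans (sym (countFin-involution n b b-invol (lowerEnd e))) (countFin-cong n λ x →
               cong₂ _∧_ (sym (sameOrbit-resp e x (b x) (sameOrbit-b x))) (cong (λ w → toℕ (b x) <ᵇ toℕ w) (b-invol x)))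
      split : size e ≡ countFin n (lowerEnd e) + countFin n upperEnd
      split = trans (countFin-cong n lower-or-upper) (countFin-∨ n not-both)
        where
          lower-or-upper : ∀ x → sameOrbit b r e x ≡ lowerEnd e x ∨ upperEnd x
          lower-or-upper x with sameOrbit b r e x
          ... | false = refl
          ... | true with <-cmp (toℕ x) (toℕ (b x))
          ... | tri< x<bx _ _ rewrite <⇒<ᵇ≡true x<bx = refl
          ... | tri≈ _ x≡bx _ = ⊥-elim (b-fpf x (sym (toℕ-injective x≡bx)))
          ... | tri> _ _ bx<x rewrite <⇒<ᵇ≡true bx<x = sym (∨-zeroʳ _)
          not-both : ∀ x → lowerEnd e x ∧ upperEnd x ≡ false
          not-both x with sameOrbit b r e x | toℕ x <ᵇ toℕ (b x) in x<bx | toℕ (b x) <ᵇ toℕ x in bx<x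
          ... | false | _ | _ = refl
          ... | true | false | _ = refl
          ... | true | true | false = refl
          ... | true | true | true = ⊥-elim (<-asym (<ᵇ≡true⇒< {toℕ x} x<bx) (<ᵇ≡true⇒< {toℕ (b x)} bx<x))

module LocalWeights {c ℓ : Level} (R : CommutativeRing c ℓ) (H : Gehm)
  (u : CommutativeRing.Carrier R) (ρ : ℕ → CommutativeRing.Carrier R)
  (ρ-power : ∀ d → 2 ≤ d → CommutativeRing._≈_ R (pow R (ρ d) d) (pow R u (d ∸ 1))) where
  open Counting
  open import Data.Nat.Base using (zero; suc; z≤n; s≤s; _<ᵇ_; _≡ᵇ_)
  open import Data.Nat.Properties using (<-cmp)
  open import Data.Bool.Base using (false; if_then_else_; _∧_; _∨_; not)
  open import Data.Bool.Properties using (not-injective; ∨-conicalˡ; ∨-conicalʳ)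
  open import Data.Fin.Base using (toℕ)
  open import Data.Fin.Properties using (toℕ-injective)
  open import Data.Product using (_×_; _,_; proj₁; proj₂)
  open import Data.Sum using (_⊎_; inj₁; inj₂; [_,_]′)
  import Data.Sum as ⊎
  open import Data.Empty using (⊥; ⊥-elim)
  import Relation.Binary.PropositionalEquality as ≡
  open ≡ using (_≡_; _≢_)
  open import Relation.Binary.Definitions using (tri<; tri≈; tri>)

  open Gehm H
  open CommutativeRing R hiding (zero) renaming (Carrier to K)
  open RingSums R
  open Hyperedges H
  open Degrees H

  Ω : Fin n → Fin n → K
  Ω = Ωm R H ρ

  pairedAt : (Fin n → Fin n) → Fin n → Bool
  pairedAt σ x = not (eqᵇ (σ x) x) ∧ eqᵇ (σ (σ x)) x ∧ sameOrbit b r x (σ x)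

  -- As in ω, the pair {x, σ x} is weighted at its smaller end.
  vertexWeight : (Fin n → Fin n) → Fin n → K
  vertexWeight σ x = 𝟙 (pairedAt σ x) * (if toℕ x <ᵇ toℕ (σ x) then Ω x (σ x) else 1#)

  onHyperedge : Fin n → (Fin n → K) → K
  onHyperedge e F = ∏ (λ x → if sameOrbit b r e x then F x else 1#)

  agreesOn : Fin n → (Fin n → Fin n) → (Fin n → Fin n) → K
  agreesOn e σ τ = onHyperedge e (λ x → 𝟙 (eqᵇ (σ x) (τ x)))

  hyperedgeWeight : Fin n → (Fin n → Fin n) → K
  hyperedgeWeight e σ = agreesOn e σ r + pow R u (deg H e ∸ 1) * agreesOn e σ b

  onHyperedge-cong : ∀ e {F G : Fin n → K} → (∀ x → sameOrbit b r e x ≡ true → F x ≈ G x) →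
                     onHyperedge e F ≈ onHyperedge e G
  onHyperedge-cong e {F} {G} F≈G = ∏-cong factor
    where
      factor : ∀ x → (if sameOrbit b r e x then F x else 1#) ≈ (if sameOrbit b r e x then G x else 1#)
      factor x with sameOrbit b r e x in ex
      ... | true = F≈G x ex
      ... | false = refl

  onHyperedge-one : ∀ e {F : Fin n → K} → (∀ x → sameOrbit b r e x ≡ true → F x ≈ 1#) → onHyperedge e F ≈ 1#
  onHyperedge-one e {F} F≈1 = ∏-one _ factor
    where
      factor : ∀ x → (if sameOrbit b r e x then F x else 1#) ≈ 1#
      factor x with sameOrbit b r e x in ex
      ... | true = F≈1 x ex
      ... | false = refl

  onHyperedge-zero : ∀ e {F : Fin n → K} m → sameOrbit b r e m ≡ true → F m ≈ 0# → onHyperedge e F ≈ 0#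
  onHyperedge-zero e {F} m em Fm≈0 = ∏-zero _ m (≡.subst (λ w → (if w then F m else 1#) ≈ 0#) (≡.sym em) Fm≈0)

  onHyperedge-pow : ∀ e {F : Fin n → K} (p : Fin n → Bool) a →
                    (∀ x → sameOrbit b r e x ≡ true → F x ≈ (if p x then a else 1#)) →
                    onHyperedge e F ≈ pow R a (countFin n (λ x → sameOrbit b r e x ∧ p x))
  onHyperedge-pow e {F} p a F≈ = trans (∏-cong factor) (∏-pow n _ a)
    where
      factor : ∀ x → (if sameOrbit b r e x then F x else 1#) ≈ (if sameOrbit b r e x ∧ p x then a else 1#)
      factor x with sameOrbit b r e x in ex
      ... | true = F≈ x ex
      ... | false = refl

  𝟙-eqᵇ-≡ : ∀ {y z : Fin n} → y ≡ z → 𝟙 (eqᵇ y z) ≈ 1#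
  𝟙-eqᵇ-≡ {y} ≡.refl = ≡⇒≈ (≡.cong 𝟙 (eqᵇ-refl y))

  𝟙-eqᵇ-≢ : ∀ {y z : Fin n} → y ≢ z → 𝟙 (eqᵇ y z) ≈ 0#
  𝟙-eqᵇ-≢ y≢z = ≡⇒≈ (≡.cong 𝟙 (≢⇒eqᵇ≡false y≢z))

  -- The weight of a b-pair at a vertex of degree 2d: ρ d stands for u^{1-1/d}, and when d = 1 (so b = r
  -- on the hyperedge) the c- and d-states coincide and carry 2 = 1 + u^0.
  cStateWeight : ℕ → K
  cStateWeight d = if d ≡ᵇ 1 then 1# + 1# else ρ d

  Ω-b : ∀ x → Ω x (b x) ≡ cStateWeight (deg H x)
  Ω-b x with deg H x ≡ᵇ 1
  ... | true = ≡.refl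
  ... | false rewrite eqᵇ-refl (b x) = ≡.refl

  2≤d⇒d≢ᵇ1 : ∀ d → 2 ≤ d → (d ≡ᵇ 1) ≡ false
  2≤d⇒d≢ᵇ1 (suc zero) (s≤s ())
  2≤d⇒d≢ᵇ1 (suc (suc d)) _ = ≡.refl

  Ω-r : ∀ x → 2 ≤ deg H x → r x ≢ b x → Ω x (r x) ≡ 1#
  Ω-r x 2≤d r≢b rewrite 2≤d⇒d≢ᵇ1 (deg H x) 2≤d | ≢⇒eqᵇ≡false r≢b | eqᵇ-refl (r x) = ≡.refl

  Ω-other : ∀ x y → 2 ≤ deg H x → y ≢ b x → y ≢ r x → Ω x y ≡ 0#
  Ω-other x y 2≤d y≢b y≢r rewrite 2≤d⇒d≢ᵇ1 (deg H x) 2≤d | ≢⇒eqᵇ≡false y≢b | ≢⇒eqᵇ≡false y≢r = ≡.refl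

  cStateWeight-power : ∀ d → 1 ≤ d → pow R (cStateWeight d) d ≈ 𝟙 (d ≡ᵇ 1) + pow R u (d ∸ 1) * 1#
  cStateWeight-power (suc zero) _ = trans (*-identityʳ _) (+-congˡ (sym (*-identityʳ _)))
  cStateWeight-power (suc (suc d)) _ =
    trans (ρ-power (suc (suc d)) (s≤s (s≤s z≤n))) (trans (sym (*-identityʳ _)) (sym (+-identityˡ _)))

  pairedAt-intro : ∀ σ x → σ x ≢ x → σ (σ x) ≡ x → sameOrbit b r x (σ x) ≡ true → pairedAt σ x ≡ true
  pairedAt-intro σ x σx≢x σσx≡x xσx =
    ∧-intro (≡.cong not (≢⇒eqᵇ≡false σx≢x)) (∧-intro (≡.subst (λ w → eqᵇ w x ≡ true) (≡.sym σσx≡x) (eqᵇ-refl x)) xσx)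

  pairedAt-elim : ∀ σ x → pairedAt σ x ≡ true → σ x ≢ x × σ (σ x) ≡ x × sameOrbit b r x (σ x) ≡ true
  pairedAt-elim σ x h =
    (λ σx≡x → true≢false (≡.subst (λ w → eqᵇ w x ≡ true) (≡.sym σx≡x) (eqᵇ-refl x)) (not-injective (∧-elimˡ h))) ,
    eqᵇ⇒≡ (∧-elimˡ (∧-elimʳ {not (eqᵇ (σ x) x)} h)) ,
    ∧-elimʳ {eqᵇ (σ (σ x)) x} (∧-elimʳ {not (eqᵇ (σ x) x)} h)

  vertexWeight-paired : ∀ σ x → pairedAt σ x ≡ true →
                        vertexWeight σ x ≈ (if toℕ x <ᵇ toℕ (σ x) then Ω x (σ x) else 1#)
  vertexWeight-paired σ x h rewrite h = *-identityˡ _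

  vertexWeight-unpaired : ∀ σ x → pairedAt σ x ≡ false → vertexWeight σ x ≈ 0#
  vertexWeight-unpaired σ x h rewrite h = zeroˡ _

  if-one : ∀ (c : Bool) {a : K} → a ≈ 1# → (if c then a else 1#) ≈ 1#
  if-one true a≈1 = a≈1
  if-one false _ = refl

  paired-when-agrees : ∀ e σ (κ : Fin n → Fin n) → (∀ x → κ (κ x) ≡ x) → (∀ x → κ x ≢ x) →
                       (∀ x → sameOrbit b r x (κ x) ≡ true) → (∀ x → sameOrbit b r e x ≡ true → σ x ≡ κ x) →
                       ∀ x → sameOrbit b r e x ≡ true → pairedAt σ x ≡ true
  paired-when-agrees e σ κ κ-invol κ-fpf x~κx σ≡κ x ex =
    pairedAt-intro σ x (λ σx≡x → κ-fpf x (≡.trans (≡.sym (σ≡κ x ex)) σx≡x))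
      (≡.trans (≡.cong σ (σ≡κ x ex)) (≡.trans (σ≡κ (κ x) (br.sameOrbit-trans e x (κ x) ≡.refl ex (x~κx x))) (κ-invol x)))
      (≡.subst (λ w → sameOrbit b r x w ≡ true) (≡.sym (σ≡κ x ex)) (x~κx x))

  weight-when-b : ∀ e σ → (∀ x → sameOrbit b r e x ≡ true → σ x ≡ b x) →
                  onHyperedge e (vertexWeight σ) ≈ hyperedgeWeight e σ
  weight-when-b e σ σ≡b = begin
    onHyperedge e (vertexWeight σ)
      ≈⟨ onHyperedge-pow e (λ x → toℕ x <ᵇ toℕ (b x)) (cStateWeight d) factor ⟩
    pow R (cStateWeight d) (countFin n (lowerEnd e))
      ≡⟨ ≡.cong (pow R (cStateWeight d)) (≡.sym (deg≡#b-edges e)) ⟩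
    pow R (cStateWeight d) d
      ≈⟨ cStateWeight-power d (deg≥1 e) ⟩
    𝟙 (d ≡ᵇ 1) + pow R u (d ∸ 1) * 1#
      ≈⟨ +-cong r-part (*-congˡ (sym b-part)) ⟩
    hyperedgeWeight e σ ∎
    where
      open import Relation.Binary.Reasoning.Setoid setoid
      d = deg H e
      factor : ∀ x → sameOrbit b r e x ≡ true → vertexWeight σ x ≈ (if toℕ x <ᵇ toℕ (b x) then cStateWeight d else 1#)
      factor x ex = trans (vertexWeight-paired σ x (paired-when-agrees e σ b b-invol b-fpf sameOrbit-b σ≡b x ex))
        (≡⇒≈ (≡.trans (≡.cong (λ w → if toℕ x <ᵇ toℕ w then Ω x w else 1#) (σ≡b x ex))
                      (≡.cong (if toℕ x <ᵇ toℕ (b x) then_else 1#)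
                              (≡.trans (Ω-b x) (≡.cong cStateWeight (deg-resp e x ex))))))
      b-part : agreesOn e σ b ≈ 1#
      b-part = onHyperedge-one e (λ x ex → 𝟙-eqᵇ-≡ (σ≡b x ex))
      r-part : 𝟙 (d ≡ᵇ 1) ≈ agreesOn e σ r
      r-part with deg-dichotomy e
      ... | inj₁ (d≡1 , b≡r) = ≡.subst (λ k → 𝟙 (k ≡ᵇ 1) ≈ agreesOn e σ r) (≡.sym d≡1)
              (sym (onHyperedge-one e (λ x ex → 𝟙-eqᵇ-≡ (≡.trans (σ≡b x ex) (b≡r x ex)))))
      ... | inj₂ (2≤d , b≢r) = ≡.subst (λ k → 𝟙 k ≈ agreesOn e σ r) (≡.sym (2≤d⇒d≢ᵇ1 d 2≤d))
              (sym (onHyperedge-zero e e ee (𝟙-eqᵇ-≢ λ σe≡re → b≢r e ee (≡.trans (≡.sym (σ≡b e ee)) σe≡re))))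
        where ee = br.sameOrbit-refl e ≡.refl

  weight-when-r : ∀ e σ x₀ → sameOrbit b r e x₀ ≡ true → σ x₀ ≢ b x₀ → (∀ x → sameOrbit b r e x ≡ true → σ x ≡ r x) →
                  onHyperedge e (vertexWeight σ) ≈ hyperedgeWeight e σ
  weight-when-r e σ x₀ ex₀ σx₀≢b σ≡r with deg-dichotomy e
  ... | inj₁ (_ , b≡r) = ⊥-elim (σx₀≢b (≡.trans (σ≡r x₀ ex₀) (≡.sym (b≡r x₀ ex₀))))
  ... | inj₂ (2≤d , b≢r) = trans (onHyperedge-one e factor≈1)
    (sym (trans (+-cong r-part (*-congˡ b-part)) (trans (+-congˡ (zeroʳ _)) (+-identityʳ _))))
    where
      factor≈1 : ∀ x → sameOrbit b r e x ≡ true → vertexWeight σ x ≈ 1#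
      factor≈1 x ex = trans (vertexWeight-paired σ x (paired-when-agrees e σ r r-invol r-fpf sameOrbit-r σ≡r x ex))
        (trans (≡⇒≈ (≡.cong (λ w → if toℕ x <ᵇ toℕ w then Ω x w else 1#) (σ≡r x ex)))
               (if-one (toℕ x <ᵇ toℕ (r x))
                       (≡⇒≈ (Ω-r x (≡.subst (2 ≤_) (≡.sym (deg-resp e x ex)) 2≤d) (λ r≡b → b≢r x ex (≡.sym r≡b))))))
      r-part : agreesOn e σ r ≈ 1#
      r-part = onHyperedge-one e (λ x ex → 𝟙-eqᵇ-≡ (σ≡r x ex))
      b-part : agreesOn e σ b ≈ 0#
      b-part = onHyperedge-zero e x₀ ex₀ (𝟙-eqᵇ-≢ σx₀≢b)

  vertexWeight-stray : ∀ σ x → pairedAt σ x ≡ true → toℕ x Data.Nat.Base.< toℕ (σ x) → 2 ≤ deg H x →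
                       σ x ≢ b x → σ x ≢ r x → vertexWeight σ x ≈ 0#
  vertexWeight-stray σ x paired x<σx 2≤d σx≢b σx≢r = trans (vertexWeight-paired σ x paired)
    (≡⇒≈ (≡.trans (≡.cong (λ c → if c then Ω x (σ x) else 1#) (<⇒<ᵇ≡true x<σx)) (Ω-other x (σ x) 2≤d σx≢b σx≢r)))

  stray-pair-vanishes : ∀ e σ x → sameOrbit b r e x ≡ true → (∀ y → sameOrbit b r e y ≡ true → pairedAt σ y ≡ true) →
                        σ x ≢ b x → σ x ≢ r x → onHyperedge e (vertexWeight σ) ≈ 0#
  stray-pair-vanishes e σ x ex paired σx≢b σx≢r with pairedAt-elim σ x (paired x ex) | deg-dichotomy e
  ... | σx≢x , _ , x~σx | inj₁ (_ , b≡r) with class-when-b≡r x (b≡r x ex) (σ x) x~σx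
  ...   | inj₁ σx≡x = ⊥-elim (σx≢x σx≡x)
  ...   | inj₂ σx≡bx = ⊥-elim (σx≢b σx≡bx)
  stray-pair-vanishes e σ x ex paired σx≢b σx≢r | σx≢x , σσx≡x , x~σx | inj₂ (2≤d , _) with <-cmp (toℕ x) (toℕ (σ x))
  ... | tri< x<σx _ _ = onHyperedge-zero e x ex (vertexWeight-stray σ x (paired x ex) x<σx (2≤deg x ex) σx≢b σx≢r)
    where 2≤deg = λ z ez → ≡.subst (2 ≤_) (≡.sym (deg-resp e z ez)) 2≤d
  ... | tri≈ _ x≡σx _ = ⊥-elim (σx≢x (≡.sym (toℕ-injective x≡σx)))
  ... | tri> _ _ σx<x = onHyperedge-zero e y ey
          (vertexWeight-stray σ y (paired y ey) (≡.subst (λ w → toℕ y Data.Nat.Base.< toℕ w) (≡.sym σσx≡x) σx<x)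
             (≡.subst (2 ≤_) (≡.sym (deg-resp e y ey)) 2≤d) σy≢b σy≢r)
    where
      y = σ x
      ey = br.sameOrbit-trans e x y ≡.refl ex x~σx
      σy≢b : σ y ≢ b y
      σy≢b σy≡by = σx≢b (≡.trans (≡.sym (b-invol y)) (≡.cong b (≡.trans (≡.sym σy≡by) σσx≡x)))
      σy≢r : σ y ≢ r y
      σy≢r σy≡ry = σx≢r (≡.trans (≡.sym (r-invol y)) (≡.cong r (≡.trans (≡.sym σy≡ry) σσx≡x)))

  agree-propagates : ∀ σ (κ : Fin n → Fin n) y → κ (κ y) ≡ y → σ (σ y) ≡ y → σ y ≡ κ y → σ (κ y) ≡ κ (κ y)
  agree-propagates σ κ y κκy σσy σy≡κy = ≡.trans (≡.cong σ (≡.sym σy≡κy)) (≡.trans σσy (≡.sym κκy))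

  agree-crosses : ∀ σ (κ λ′ : Fin n → Fin n) y → λ′ (λ′ y) ≡ y → σ (σ (λ′ y)) ≡ λ′ y → κ y ≢ λ′ y → σ y ≡ κ y →
                  σ (λ′ y) ≡ κ (λ′ y) ⊎ σ (λ′ y) ≡ λ′ (λ′ y) → σ (λ′ y) ≡ κ (λ′ y)
  agree-crosses σ κ λ′ y λλy σσλy κy≢λy σy≡κy (inj₁ σλy≡κλy) = σλy≡κλy
  agree-crosses σ κ λ′ y λλy σσλy κy≢λy σy≡κy (inj₂ σλy≡λλy) =
    ⊥-elim (κy≢λy (≡.trans (≡.sym σy≡κy) (≡.trans (≡.cong σ (≡.sym (≡.trans σλy≡λλy λλy))) σσλy)))

  matching-uniform : ∀ e σ → (∀ x → sameOrbit b r e x ≡ true → σ (σ x) ≡ x) →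
                     (∀ x → sameOrbit b r e x ≡ true → σ x ≡ b x ⊎ σ x ≡ r x) →
                     (∀ x → sameOrbit b r e x ≡ true → b x ≢ r x) →
                     (∀ x → sameOrbit b r e x ≡ true → σ x ≡ b x) ⊎ (∀ x → sameOrbit b r e x ≡ true → σ x ≡ r x)
  matching-uniform e σ σσ b-or-r b≢r with b-or-r e (br.sameOrbit-refl e ≡.refl)
  ... | inj₁ σe≡be = inj₁ λ x ex → proj₂ (br.sameOrbit-ind e (λ y → sameOrbit b r e y ≡ true × σ y ≡ b y) ≡.refl
          (br.sameOrbit-refl e ≡.refl , σe≡be)
          (λ y _ (ey , σy≡by) → br.sameOrbit-α e y ≡.refl ey , agree-propagates σ b y (b-invol y) (σσ y ey) σy≡by)
          (λ y _ (ey , σy≡by) → let ery = br.sameOrbit-β e y ≡.refl ey in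
             ery , agree-crosses σ b r y (r-invol y) (σσ (r y) ery) (b≢r y ey) σy≡by (b-or-r (r y) ery))
          x ex)
  ... | inj₂ σe≡re = inj₂ λ x ex → proj₂ (br.sameOrbit-ind e (λ y → sameOrbit b r e y ≡ true × σ y ≡ r y) ≡.refl
          (br.sameOrbit-refl e ≡.refl , σe≡re)
          (λ y _ (ey , σy≡ry) → let eby = br.sameOrbit-α e y ≡.refl ey in
             eby , agree-crosses σ r b y (b-invol y) (σσ (b y) eby) (λ ry≡by → b≢r y ey (≡.sym ry≡by)) σy≡ry
                                 (⊎.swap (b-or-r (b y) eby)))
          (λ y _ (ey , σy≡ry) → br.sameOrbit-β e y ≡.refl ey , agree-propagates σ r y (r-invol y) (σσ y ey) σy≡ry)
          x ex)

  weight-when-neither : ∀ e σ x₀ → sameOrbit b r e x₀ ≡ true → σ x₀ ≢ b x₀ →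
                        ∀ x₁ → sameOrbit b r e x₁ ≡ true → σ x₁ ≢ r x₁ →
                        onHyperedge e (vertexWeight σ) ≈ hyperedgeWeight e σ
  weight-when-neither e σ x₀ ex₀ σx₀≢b x₁ ex₁ σx₁≢r = trans vanishes (sym (trans
    (+-cong (onHyperedge-zero e x₁ ex₁ (𝟙-eqᵇ-≢ σx₁≢r)) (*-congˡ (onHyperedge-zero e x₀ ex₀ (𝟙-eqᵇ-≢ σx₀≢b))))
    (trans (+-identityˡ _) (zeroʳ _))))
    where
      not-uniform : (∀ x → sameOrbit b r e x ≡ true → pairedAt σ x ≡ true) →
                    (∀ x → sameOrbit b r e x ≡ true → σ x ≡ b x ⊎ σ x ≡ r x) → ⊥
      not-uniform paired b-or-r with deg-dichotomy e
      ... | inj₁ (_ , b≡r) = [ σx₀≢b , (λ σx₀≡r → σx₀≢b (≡.trans σx₀≡r (≡.sym (b≡r x₀ ex₀)))) ]′ (b-or-r x₀ ex₀)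
      ... | inj₂ (_ , b≢r) = [ (λ σ≡b → σx₀≢b (σ≡b x₀ ex₀)) , (λ σ≡r → σx₁≢r (σ≡r x₁ ex₁)) ]′
              (matching-uniform e σ (λ x ex → proj₁ (proj₂ (pairedAt-elim σ x (paired x ex)))) b-or-r b≢r)
      vanishes : onHyperedge e (vertexWeight σ) ≈ 0#
      vanishes with search-within (sameOrbit b r e) (pairedAt σ)
      ... | inj₁ (y , ey , unpaired) = onHyperedge-zero e y ey (vertexWeight-unpaired σ y unpaired)
      ... | inj₂ paired with search-within (sameOrbit b r e) (λ y → eqᵇ (σ y) (b y) ∨ eqᵇ (σ y) (r y))
      ...   | inj₁ (y , ey , stray) = stray-pair-vanishes e σ y ey paired
                (eqᵇ≡false⇒≢ (∨-conicalˡ _ _ stray)) (eqᵇ≡false⇒≢ (∨-conicalʳ _ _ stray))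
      ...   | inj₂ on-cycle = ⊥-elim (not-uniform paired λ x ex →
                ⊎.map eqᵇ⇒≡ eqᵇ⇒≡ (∨-elim (on-cycle x ex)))

  vertexWeights≈hyperedgeWeight : ∀ e σ → onHyperedge e (vertexWeight σ) ≈ hyperedgeWeight e σ
  vertexWeights≈hyperedgeWeight e σ with search-within (sameOrbit b r e) (λ x → eqᵇ (σ x) (b x))
  ... | inj₂ σ≡b = weight-when-b e σ (λ x ex → eqᵇ⇒≡ (σ≡b x ex))
  ... | inj₁ (x₀ , ex₀ , σx₀≢b) with search-within (sameOrbit b r e) (λ x → eqᵇ (σ x) (r x))
  ...   | inj₂ σ≡r = weight-when-r e σ x₀ ex₀ (eqᵇ≡false⇒≢ σx₀≢b) (λ x ex → eqᵇ⇒≡ (σ≡r x ex))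
  ...   | inj₁ (x₁ , ex₁ , σx₁≢r) = weight-when-neither e σ x₀ ex₀ (eqᵇ≡false⇒≢ σx₀≢b) x₁ ex₁ (eqᵇ≡false⇒≢ σx₁≢r)

module SubsetExpansion {c ℓ : Level} (R : CommutativeRing c ℓ) (H : Gehm) (u : CommutativeRing.Carrier R) where
  open Counting
  open import Data.Nat.Base using (zero; suc; z≤n; s≤s)
  open import Data.Nat.Properties using (+-∸-assoc; +-mono-≤)
  open import Data.Bool.Base using (false; _∨_)
  open import Data.Bool.Properties using (¬-not)
  open import Data.List.Base using ([]; _∷_; map; _++_; length)
  open import Data.Bool.ListAction using (any)
  open import Data.List.Relation.Unary.AllPairs using ([]; _∷_)
  open import Data.List.Relation.Unary.Unique.Propositional using (Unique)
  open import Data.List.Relation.Unary.Unique.Propositional.Properties using (Unique[x∷xs]⇒x∉xs)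
  open import Data.Product using (_,_)
  import Relation.Binary.PropositionalEquality as ≡
  open ≡ using (_≡_)

  open Gehm H
  open CommutativeRing R hiding (zero) renaming (Carrier to K)
  open RingSums R
  open Degrees H
  open import Relation.Binary.Reasoning.Setoid setoid

  subsetWeight : List (Fin n) → K
  subsetWeight A = pow R u (dSum H A ∸ length A)

  length≤dSum : ∀ A → length A ≤ dSum H A
  length≤dSum [] = z≤n
  length≤dSum (a ∷ A) = +-mono-≤ (deg≥1 a) (length≤dSum A)

  subsetWeight-∷ : ∀ e A → subsetWeight (e ∷ A) ≈ pow R u (deg H e ∸ 1) * subsetWeight A
  subsetWeight-∷ e A with deg H e | deg≥1 e
  ... | suc d | s≤s _ = trans (≡⇒≈ (≡.cong (pow R u) (+-∸-assoc d (length≤dSum A)))) (pow-+ u d _)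

  term : (Fin n → Bool → K) → List (Fin n) → List (Fin n) → K
  term G L A = subsetWeight A * ∏ₗ (λ e → G e (any (eqᵇ e) A)) L

  term-without : ∀ G e L → Unique (e ∷ L) → ∀ A → A ∈ sublists L → term G (e ∷ L) A ≈ G e false * term G L A
  term-without G e L uniq A A∈ =
    trans (*-congˡ (*-congʳ (≡⇒≈ (≡.cong (G e) e∉A))))
          (trans (sym (*-assoc _ _ _)) (trans (*-congʳ (*-comm _ _)) (*-assoc _ _ _)))
    where
      e∉A : any (eqᵇ e) A ≡ false
      e∉A = ¬-not λ e∈A → let a , a∈A , e≡a = any-∈⁻ (eqᵇ e) A e∈A in
        Unique[x∷xs]⇒x∉xs uniq (≡.subst (_∈ L) (≡.sym (eqᵇ⇒≡ e≡a)) (sublists-⊆ L A∈ a∈A))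

  term-with : ∀ G e L → Unique (e ∷ L) → ∀ A → term G (e ∷ L) (e ∷ A) ≈ (pow R u (deg H e ∸ 1) * G e true) * term G L A
  term-with G e L uniq A =
    trans (*-cong (subsetWeight-∷ e A)
                  (*-cong (≡⇒≈ (≡.cong (λ w → G e (w ∨ any (eqᵇ e) A)) (eqᵇ-refl e))) (∏ₗ-cong L others)))
          (*-interchange _ _ _ _)
    where
      others : ∀ e′ → e′ ∈ L → G e′ (eqᵇ e′ e ∨ any (eqᵇ e′) A) ≈ G e′ (any (eqᵇ e′) A)
      others e′ e′∈L = ≡⇒≈ (≡.cong (λ w → G e′ (w ∨ any (eqᵇ e′) A))
                                  (≢⇒eqᵇ≡false λ e′≡e → Unique[x∷xs]⇒x∉xs uniq (≡.subst (_∈ L) e′≡e e′∈L)))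

  expand-product : ∀ (G : Fin n → Bool → K) L → Unique L →
                   ∑ₗ (term G L) (sublists L) ≈ ∏ₗ (λ e → G e false + pow R u (deg H e ∸ 1) * G e true) L
  expand-product G [] _ = trans (+-identityʳ _) (*-identityʳ _)
  expand-product G (e ∷ L) uniq@(_ ∷ uniq′) = begin
    ∑ₗ (term G (e ∷ L)) (sublists L ++ map (e ∷_) (sublists L))
      ≈⟨ ∑ₗ-++ (term G (e ∷ L)) (sublists L) (map (e ∷_) (sublists L)) ⟩
    ∑ₗ (term G (e ∷ L)) (sublists L) + ∑ₗ (term G (e ∷ L)) (map (e ∷_) (sublists L))
      ≡⟨ ≡.cong (∑ₗ (term G (e ∷ L)) (sublists L) +_) (∑ₗ-map (term G (e ∷ L)) (e ∷_) (sublists L)) ⟩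
    ∑ₗ (term G (e ∷ L)) (sublists L) + ∑ₗ (λ A → term G (e ∷ L) (e ∷ A)) (sublists L)
      ≈⟨ +-cong (∑ₗ-cong (sublists L) (term-without G e L uniq)) (∑ₗ-cong (sublists L) (λ A _ → term-with G e L uniq A)) ⟩
    ∑ₗ (λ A → G e false * term G L A) (sublists L) + ∑ₗ (λ A → chosen * term G L A) (sublists L)
      ≈⟨ +-cong (∑ₗ-distribˡ _ (term G L) (sublists L)) (∑ₗ-distribˡ _ (term G L) (sublists L)) ⟩
    G e false * ∑ₗ (term G L) (sublists L) + chosen * ∑ₗ (term G L) (sublists L)
      ≈⟨ distribʳ _ _ _ ⟨
    (G e false + chosen) * ∑ₗ (term G L) (sublists L)
      ≈⟨ *-congˡ (expand-product G L uniq′) ⟩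
    ∏ₗ (λ e → G e false + pow R u (deg H e ∸ 1) * G e true) (e ∷ L) ∎
    where
      chosen : K
      chosen = pow R u (deg H e ∸ 1) * G e true

module MedialExpansion {c ℓ : Level} (R : CommutativeRing c ℓ) (H : Gehm)
  (u v : CommutativeRing.Carrier R) (ρ : ℕ → CommutativeRing.Carrier R)
  (ρ-power : ∀ d → 2 ≤ d → CommutativeRing._≈_ R (pow R (ρ d) d) (pow R u (d ∸ 1))) where
  open Counting
  open Orbits
  open import Data.Nat.Base using (ℕ; zero; _≤_; _≤ᵇ_; _<ᵇ_; _∸_) renaming (_+_ to _+ℕ_)
  open import Data.Bool.Base using (false; if_then_else_; _∨_)
  open import Data.Fin.Base using (toℕ)
  open import Data.List.Base using ([]; _∷_; map)
  open import Data.Bool.ListAction using (all; any)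
  open import Data.Vec.Base using (Vec; lookup)
  open import Data.List.Relation.Unary.Any using (here; there)
  open import Data.List.Relation.Unary.AllPairs using ([]; _∷_)
  open import Data.List.Relation.Unary.Unique.Propositional using (Unique)
  open import Data.List.Relation.Unary.Unique.Propositional.Properties using (Unique[x∷xs]⇒x∉xs; allFin⁺)
  open import Data.Product using (_,_; proj₁; proj₂)
  open import Data.Sum using (inj₁; inj₂)
  open import Data.Empty using (⊥-elim)
  open import Function.Base using (_∘_)
  import Relation.Binary.PropositionalEquality as ≡
  open ≡ using (_≡_)

  open Gehm H
  open CommutativeRing R hiding (zero) renaming (Carrier to K)
  open RingSums R
  open Hyperedges H
  open LocalWeights R H u ρ ρ-power
  open SubsetExpansion R H u
  open import Relation.Binary.Reasoning.Setoid setoid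

  hyperedges-unique : Unique (hyperedges H)
  hyperedges-unique = Unique-keep (isRep b r) (allFin⁺ n)

  ∏-by-hyperedges-of : ∀ L → Unique L → (∀ e → e ∈ L → isRep b r e ≡ true) → ∀ F →
                       ∏ (λ x → if onHyperedgeOf L x then F x else 1#) ≈ ∏ₗ (λ e → onHyperedge e F) L
  ∏-by-hyperedges-of [] _ _ F = ∏-one {n} _ (λ _ → refl)
  ∏-by-hyperedges-of (e ∷ L) uniq@(_ ∷ uniq′) reps F =
    trans (∏-cong {n} split)
          (trans (∏-distrib-* {n} _ _) (*-congˡ (∏-by-hyperedges-of L uniq′ (λ e′ → reps e′ ∘ there) F)))
    where
      split : ∀ x → (if sameOrbit b r e x ∨ onHyperedgeOf L x then F x else 1#) ≈
                    (if sameOrbit b r e x then F x else 1#) * (if onHyperedgeOf L x then F x else 1#)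
      split x with sameOrbit b r e x in ex | onHyperedgeOf L x in Lx
      ... | true | true = ⊥-elim (Unique[x∷xs]⇒x∉xs uniq (≡.subst (_∈ L) (≡.sym e≡a) a∈L))
        where
          a = proj₁ (any-∈⁻ (λ a → sameOrbit b r a x) L Lx)
          a∈L = proj₁ (proj₂ (any-∈⁻ (λ a → sameOrbit b r a x) L Lx))
          e≡a = hyperedge-unique e a x (reps e (here ≡.refl)) (reps a (there a∈L)) ex
                                 (proj₂ (proj₂ (any-∈⁻ (λ a → sameOrbit b r a x) L Lx)))
      ... | true | false = sym (*-identityʳ _)
      ... | false | _ = sym (*-identityˡ _)

  ∏-by-hyperedges : ∀ F → ∏ F ≈ ∏ₗ (λ e → onHyperedge e F) (hyperedges H)
  ∏-by-hyperedges F = trans (∏-cong λ x → ≡⇒≈ (≡.cong (if_then F x else 1#) (≡.sym (covered x))))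
                            (∏-by-hyperedges-of (hyperedges H) hyperedges-unique (λ e → ∈-hyperedges⁻) F)
    where
      covered : ∀ x → onHyperedgeOf (hyperedges H) x ≡ true
      covered x = let e , e∈ , ex = hyperedge-exists x in any-∈⁺ (λ a → sameOrbit b r a x) e∈ ex

  agreesOnAs : Fin n → (Fin n → Fin n) → Bool → K
  agreesOnAs e σ true = agreesOn e σ b
  agreesOnAs e σ false = agreesOn e σ r

  agree : (Fin n → Fin n) → (Fin n → Fin n) → K
  agree σ τ = ∏ (λ x → 𝟙 (eqᵇ (σ x) (τ x)))

  agree-state : ∀ σ A → (∀ a → a ∈ A → isRep b r a ≡ true) →
                agree σ (state A) ≈ ∏ₗ (λ e → agreesOnAs e σ (any (eqᵇ e) A)) (hyperedges H)
  agree-state σ A A-reps = trans (∏-by-hyperedges _) (∏ₗ-cong (hyperedges H) λ e e∈ → on-e e (∈-hyperedges⁻ e∈))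
    where
      on-e : ∀ e → isRep b r e ≡ true →
             onHyperedge e (λ x → 𝟙 (eqᵇ (σ x) (state A x))) ≈ agreesOnAs e σ (any (eqᵇ e) A)
      on-e e rep with any (eqᵇ e) A in e∈A
      ... | true = onHyperedge-cong e λ x ex → ≡⇒≈ (≡.cong (λ w → 𝟙 (eqᵇ (σ x) w))
                     (state-b A x (≡.trans (onHyperedgeOf≡∈ A A-reps e x rep ex) e∈A)))
      ... | false = onHyperedge-cong e λ x ex → ≡⇒≈ (≡.cong (λ w → 𝟙 (eqᵇ (σ x) w))
                     (state-r A x (≡.trans (onHyperedgeOf≡∈ A A-reps e x rep ex) e∈A)))

  subsets : List (List (Fin n))
  subsets = sublists (hyperedges H)

  subsets-reps : ∀ A → A ∈ subsets → ∀ a → a ∈ A → isRep b r a ≡ true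
  subsets-reps A A∈ a a∈A = ∈-hyperedges⁻ (sublists-⊆ (hyperedges H) A∈ a∈A)

  graphState-weight : ∀ σ → 𝟙 (isGraphState R (medial H) σ) * ω R (medial H) Ω σ ≈
                            ∑ₗ (λ A → subsetWeight A * agree σ (state A)) subsets
  graphState-weight σ = begin
    𝟙 (isGraphState R (medial H) σ) * ω R (medial H) Ω σ
      ≈⟨ *-cong (𝟙-all-tabulate n (pairedAt σ) (λ x → x))
                (∏ₗ-keep-tabulate n (λ x → Ω x (σ x)) (λ x → toℕ x <ᵇ toℕ (σ x)) (λ x → x)) ⟩
    ∏ (𝟙 ∘ pairedAt σ) * ∏ (λ x → if toℕ x <ᵇ toℕ (σ x) then Ω x (σ x) else 1#)
      ≈⟨ ∏-distrib-* {n} _ _ ⟨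
    ∏ (vertexWeight σ)
      ≈⟨ ∏-by-hyperedges (vertexWeight σ) ⟩
    ∏ₗ (λ e → onHyperedge e (vertexWeight σ)) (hyperedges H)
      ≈⟨ ∏ₗ-cong (hyperedges H) (λ e _ → vertexWeights≈hyperedgeWeight e σ) ⟩
    ∏ₗ (λ e → hyperedgeWeight e σ) (hyperedges H)
      ≈⟨ expand-product (λ e → agreesOnAs e σ) (hyperedges H) hyperedges-unique ⟨
    ∑ₗ (λ A → subsetWeight A * ∏ₗ (λ e → agreesOnAs e σ (any (eqᵇ e) A)) (hyperedges H)) subsets
      ≈⟨ ∑ₗ-cong subsets (λ A A∈ → *-congˡ (agree-state σ A (subsets-reps A A∈))) ⟨
    ∑ₗ (λ A → subsetWeight A * agree σ (state A)) subsets ∎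

  curveWeight : (Fin n → Fin n) → K
  curveWeight σ = pow R v (kState R (medial H) σ)

  kState-cong : ∀ σ τ → (∀ x → σ x ≡ τ x) → kState R (medial H) σ ≡ kState R (medial H) τ
  kState-cong σ τ σ≗τ = ≡.cong (_+ℕ isolates) (≡.trans (count-allFin n _) (≡.trans
    (countFin-cong n λ x → ≡.cong (all (λ y → toℕ x ≤ᵇ toℕ y)) (orbit-cong g σ≗τ x)) (≡.sym (count-allFin n _))))

  agree-curveWeight : ∀ σ τ → agree σ τ * curveWeight σ ≈ agree σ τ * curveWeight τ
  agree-curveWeight σ τ with search-within (λ _ → true) (λ x → eqᵇ (σ x) (τ x))
  ... | inj₁ (x , _ , σx≢τx) = trans (*-congʳ disagree) (trans (zeroˡ _) (sym (trans (*-congʳ disagree) (zeroˡ _))))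
    where disagree = ∏-zero {n} _ x (𝟙-eqᵇ-≢ (eqᵇ≡false⇒≢ σx≢τx))
  ... | inj₂ σ≡τ = *-congˡ (≡⇒≈ (≡.cong (pow R v) (kState-cong σ τ (λ x → eqᵇ⇒≡ (σ≡τ x ≡.refl)))))

  contribution : Vec (Fin n) n → List (Fin n) → K
  contribution w A = (subsetWeight A * agree (lookup w) (state A)) * curveWeight (lookup w)

  ∑-states-agreeing : ∀ A → ∑ₗ (λ w → contribution w A) (allVecs n) ≈ subsetWeight A * curveWeight (state A)
  ∑-states-agreeing A = begin
    ∑ₗ (λ w → contribution w A) (allVecs n)
      ≈⟨ ∑ₗ-cong (allVecs n) (λ w _ → trans (*-assoc _ _ _) (*-congˡ (agree-curveWeight (lookup w) (state A)))) ⟩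
    ∑ₗ (λ w → subsetWeight A * (agree (lookup w) (state A) * curveWeight (state A))) (allVecs n)
      ≈⟨ ∑ₗ-distribˡ _ _ (allVecs n) ⟩
    subsetWeight A * ∑ₗ (λ w → agree (lookup w) (state A) * curveWeight (state A)) (allVecs n)
      ≈⟨ *-congˡ (∑ₗ-distribʳ _ _ (allVecs n)) ⟩
    subsetWeight A * (∑ₗ (λ w → agree (lookup w) (state A)) (allVecs n) * curveWeight (state A))
      ≈⟨ *-congˡ (trans (*-congʳ (∑-agreeing-vectors n (state A))) (*-identityˡ _)) ⟩
    subsetWeight A * curveWeight (state A) ∎

  Φ≈Z : Φ R (medial H) Ω v ≈ Z R H u v
  Φ≈Z = begin
    Φ R (medial H) Ω v
      ≈⟨ ∑ₗ-keep summand (isGraphState R (medial H)) (map lookup (allVecs n)) ⟩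
    ∑ₗ (λ σ → 𝟙 (isGraphState R (medial H) σ) * summand σ) (map lookup (allVecs n))
      ≡⟨ ∑ₗ-map _ lookup (allVecs n) ⟩
    ∑ₗ (λ w → 𝟙 (isGraphState R (medial H) (lookup w)) * summand (lookup w)) (allVecs n)
      ≈⟨ ∑ₗ-cong (allVecs n) (λ w _ → trans (sym (*-assoc _ _ _)) (*-congʳ (graphState-weight (lookup w)))) ⟩
    ∑ₗ (λ w → ∑ₗ (λ A → subsetWeight A * agree (lookup w) (state A)) subsets * curveWeight (lookup w)) (allVecs n)
      ≈⟨ ∑ₗ-cong (allVecs n) (λ w _ → sym (∑ₗ-distribʳ _ _ subsets)) ⟩
    ∑ₗ (λ w → ∑ₗ (contribution w) subsets) (allVecs n)
      ≈⟨ ∑ₗ-comm contribution (allVecs n) subsets ⟩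
    ∑ₗ (λ A → ∑ₗ (λ w → contribution w A) (allVecs n)) subsets
      ≈⟨ ∑ₗ-cong subsets (λ A _ → ∑-states-agreeing A) ⟩
    ∑ₗ (λ A → subsetWeight A * curveWeight (state A)) subsets
      ≈⟨ ∑ₗ-cong subsets (λ A A∈ →
           *-congˡ (≡⇒≈ (≡.cong (pow R v) (≡.sym (Restriction.f≡orbits H A (subsets-reps A A∈)))))) ⟩
    Z R H u v ∎
    where
      summand : (Fin n → Fin n) → K
      summand σ = ω R (medial H) Ω σ * curveWeight σ

theorem2 : ∀ {c ℓ : Level} (R : CommutativeRing c ℓ) (H : Gehm)
             (u v : CommutativeRing.Carrier R) (ρ : ℕ → CommutativeRing.Carrier R) →
             (∀ d → 2 ≤ d → CommutativeRing._≈_ R (pow R (ρ d) d) (pow R u (d ∸ 1))) →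
             CommutativeRing._≈_ R (Φ R (medial H) (Ωm R H ρ) v) (Z R H u v)
theorem2 R H u v ρ ρ-power = MedialExpansion.Φ≈Z R H u v ρ ρ-power
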